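{- Let $s$ be a fixed positive integer, $p$ a prime, $\mathcal{M}\subseteq\mathbb{F}_p^*$ with $M=|\mathcal{M}|<p^{1/2}$, and let $H$ be a positive integer with $H<p^{1/2}$, $\mathcal{H}=\{1,2,\ldots,H\}$. Then the set $$\mathcal{M}\cdot\mathcal{H}^{ -s}=\{m h^{ -s}\bmod p:\ m\in\mathcal{M},\ h\in\mathcal{H}\}$$ satisfies $$|\mathcal{M}\cdot\mathcal{H}^{ -s}|\gg \min\{MH/\log p,\ H^2/\log^2 p\},$$ where the implied constant depends only on $s$.
   Context: $\mathbb{F}_p$ is the field of residues modulo $p$, identified with $\{0,1,\ldots,p-1\}$, $\mathbb{F}_p^*=\mathbb{F}_p\setminus\{0\}$. $U\gg V$ means $V\leqslant cU$ for some constant $c>0$. -}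

module Defs where

open import Data.Nat using (ℕ; suc; _+_; _*_; _∸_; _^_; NonZero; _≟_)
open import Data.Nat.DivMod using (_%_)
open import Data.Bool using (Bool; true; false; _∧_)
open import Data.Fin using (Fin; toℕ)
open import Data.Fin.Subset using (Subset; inside; outside; _∈_)
open import Data.Fin.Subset.Properties using (_∈?_)
open import Data.List using (List; allFin; upTo; map)
open import Data.Bool.ListAction using (any)
open import Data.Vec using (tabulate)
open import Relation.Nullary.Decidable using (⌊_⌋)

-- inverse power  h^{-s} mod p, via Fermat:  h^{-1} = h^{p-2} in F_p (p prime)
invPow : (p s h : ℕ) → ℕ
invPow p s h = h ^ (s * (p ∸ 2))

oneToH : ℕ → List ℕ
oneToH H = map suc (upTo H)

memb : (p s H : ℕ) .{{_ : NonZero p}} → Subset p → Fin p → Bool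
memb p s H M x =
  any (λ m → ⌊ m ∈? M ⌋ ∧
             any (λ h → ⌊ toℕ x ≟ (toℕ m * invPow p s h) % p ⌋) (oneToH H))
      (allFin p)

side : Bool → Data.Fin.Subset.Side
side true = inside
side false = outside

MHs : (p s H : ℕ) .{{_ : NonZero p}} → Subset p → Subset p
MHs p s H M = tabulate (λ x → side (memb p s H M x))

{-# OPTIONS --safe #-}
-- Let k be the number of primes up to H and look at the M k values m ℓ⁻ˢ with m ∈ M and ℓ ≤ H prime.
-- A coincidence m′ ℓ′⁻ˢ = m ℓ⁻ˢ with ℓ = ℓ′ forces m = m′; otherwise (ℓ / ℓ′)ˢ = m / m′, and since
-- the ratio of two distinct primes below √p determines them while m / m′ has at most s roots of
-- order s, each pair (m, m′) admits at most s such coincidences.  So there are at most M k + s M²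
-- coincidences, and Cauchy–Schwarz gives |M·H⁻ˢ| ≥ (M k)² / (M k + s M²) ≥ min(M k, k² / s) / 2.
-- Finally k ≫ H / log p by Chebyshev's bound in Nair's form: (2n + 1) · C(2n, n) ≥ 4ⁿ divides
-- lcm(1, …, 2n + 1) ≤ (2n + 1)^π(2n + 1).
module Submission where

open import Defs
open import Data.Nat
open import Data.Nat.Properties
open import Data.Nat.DivMod
  using (_%_; _mod_; m%n<n; m%n%n≡m%n; m%n≤n; %-distribˡ-+; %-distribˡ-*; m<n⇒m%n≡m; m/n*n≡m)
open import Data.Nat.Divisibility
open import Data.Nat.Primality
open import Data.Nat.Primality.Factorisation using (factorise)
open import Data.Nat.Combinatorics using (_C_; nCn≡1; nCk≡n!/k![n-k]!; k![n∸k]!∣n!)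
open import Data.Nat.Induction using (<-wellFounded)
open import Data.Nat.Logarithm using (⌊log₂_⌋; ⌊log₂⌋-mono-≤; ⌊log₂[2^n]⌋≡n)
open import Data.Nat.Solver using (module +-*-Solver)
open import Data.Bool using (Bool; true; T; _∧_)
open import Data.Bool.Properties using (T-≡; T-∧)
open import Data.Bool.ListAction using (any)
open import Data.Empty using (⊥-elim)
open import Data.Fin as Fin using (Fin; zero; suc; toℕ)
open import Data.Fin.Properties as Finₚ using (toℕ<n; toℕ-injective; toℕ-fromℕ<; toℕ-fromℕ; toℕ-inject₁)
open import Data.Fin.Subset using (Subset; inside; outside; ∣_∣) renaming (_∈_ to _∈ₛ_)
open import Data.Fin.Subset.Properties using (_∈?_; x∈p⇒∣p-x∣<∣p∣)
open import Data.List using (List; []; _∷_; _++_; map; length; replicate; filter; upTo; allFin; cartesianProduct)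
open import Data.List.Properties using (map-tabulate; length-++; length-map; length-replicate)
open import Data.List.Relation.Unary.All as All using (All; []; _∷_)
open import Data.List.Relation.Unary.All.Properties using (map⁺; all-filter)
open import Data.List.Relation.Unary.AllPairs using ([]; _∷_)
open import Data.List.Relation.Unary.Any as Any using (Any; here; there)
open import Data.List.Relation.Unary.Any.Properties using (any⁺; ¬Any[])
open import Data.List.Relation.Unary.Unique.Propositional using (Unique)
import Data.List.Relation.Unary.Unique.Propositional.Properties as Unique
open import Data.Product using (Σ; _×_; _,_; proj₁; proj₂; ∃-syntax; ∃₂)
open import Data.Sum using (inj₁; inj₂; [_,_]′)
open import Data.Vec using ([]; _∷_; here; there)
open import Data.Vec.Properties using (lookup∘tabulate; lookup⇒[]=)
open import Function using (_∘_; const; Equivalence)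
open import Induction.WellFounded using (Acc; acc)
open import Level using (0ℓ)
open import Relation.Binary using (IsEquivalence; Setoid)
import Relation.Binary.Reasoning.Setoid as SetoidReasoning
open import Relation.Binary.Definitions using (DecidableEquality)
open import Relation.Binary.PropositionalEquality
open import Relation.Nullary using (Dec; yes; no; ¬_; contradiction; map′)
open import Relation.Nullary.Decidable using (⌊_⌋; fromWitness; ¬?; _×-dec_)
open import Relation.Unary using (Decidable)
open import Algebra.Properties.CommutativeSemigroup +-commutativeSemigroup using (interchange)

open +-*-Solver using (solve; _:+_; _:*_; _:=_; con)

module FiniteSums where

  open import Data.List.Membership.Propositional using (_∈_)

  𝟙 : {P : Set} → Dec P → ℕ
  𝟙 (yes _) = 1
  𝟙 (no _)  = 0

  𝟙≤1 : {P : Set} (d : Dec P) → 𝟙 d ≤ 1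
  𝟙≤1 (yes _) = ≤-refl
  𝟙≤1 (no _)  = z≤n

  𝟙-mono : {P Q : Set} → (P → Q) → (P? : Dec P) (Q? : Dec Q) → 𝟙 P? ≤ 𝟙 Q?
  𝟙-mono P⇒Q (no _)  _        = z≤n
  𝟙-mono P⇒Q (yes _) (yes _)  = ≤-refl
  𝟙-mono P⇒Q (yes p) (no ¬q)  = ⊥-elim (¬q (P⇒Q p))

  𝟙-map′ : {P Q : Set} {f : P → Q} {g : Q → P} (P? : Dec P) → 𝟙 (map′ f g P?) ≡ 𝟙 P?
  𝟙-map′ (yes _) = refl
  𝟙-map′ (no _)  = refl

  𝟙-yes : {P : Set} (P? : Dec P) → P → 𝟙 P? ≡ 1
  𝟙-yes (yes _) _ = refl
  𝟙-yes (no ¬p) p = ⊥-elim (¬p p)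

  𝟙>0⇒ : {P : Set} (d : Dec P) → 0 < 𝟙 d → P
  𝟙>0⇒ (yes p) _ = p

  ∑ : {A : Set} → List A → (A → ℕ) → ℕ
  ∑ []       f = 0
  ∑ (x ∷ xs) f = f x + ∑ xs f

  ∑-syntax : {A : Set} → List A → (A → ℕ) → ℕ
  ∑-syntax = ∑

  infix 5 ∑-syntax
  syntax ∑-syntax xs (λ x → e) = ∑[ x ∈ xs ] e

  module _ {A : Set} where

    ∑-cong : ∀ (xs : List A) {f g : A → ℕ} → (∀ x → f x ≡ g x) → ∑ xs f ≡ ∑ xs g
    ∑-cong []       f≗g = refl
    ∑-cong (x ∷ xs) f≗g = cong₂ _+_ (f≗g x) (∑-cong xs f≗g)

    ∑-mono-≤ : ∀ (xs : List A) {f g : A → ℕ} → (∀ {x} → x ∈ xs → f x ≤ g x) → ∑ xs f ≤ ∑ xs g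
    ∑-mono-≤ []       f≤g = z≤n
    ∑-mono-≤ (x ∷ xs) f≤g = +-mono-≤ (f≤g (here refl)) (∑-mono-≤ xs (f≤g ∘ there))

    ∑-distrib-+ : ∀ (xs : List A) (f g : A → ℕ) → ∑[ x ∈ xs ] (f x + g x) ≡ ∑ xs f + ∑ xs g
    ∑-distrib-+ []       f g = refl
    ∑-distrib-+ (x ∷ xs) f g =
      trans (cong (f x + g x +_) (∑-distrib-+ xs f g)) (interchange (f x) (g x) (∑ xs f) (∑ xs g))

    *-distribˡ-∑ : ∀ c (xs : List A) (f : A → ℕ) → c * ∑ xs f ≡ ∑[ x ∈ xs ] (c * f x)
    *-distribˡ-∑ c []       f = *-zeroʳ c
    *-distribˡ-∑ c (x ∷ xs) f = trans (*-distribˡ-+ c (f x) (∑ xs f)) (cong (c * f x +_) (*-distribˡ-∑ c xs f))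

    *-distribʳ-∑ : ∀ c (xs : List A) (f : A → ℕ) → ∑ xs f * c ≡ ∑[ x ∈ xs ] (f x * c)
    *-distribʳ-∑ c xs f =
      trans (*-comm (∑ xs f) c) (trans (*-distribˡ-∑ c xs f) (∑-cong xs (λ x → *-comm c (f x))))

    ∑-const : ∀ (xs : List A) c → ∑[ x ∈ xs ] c ≡ length xs * c
    ∑-const []       c = refl
    ∑-const (x ∷ xs) c = cong (c +_) (∑-const xs c)

    ∑-++ : ∀ (xs ys : List A) (f : A → ℕ) → ∑ (xs ++ ys) f ≡ ∑ xs f + ∑ ys f
    ∑-++ []       ys f = refl
    ∑-++ (x ∷ xs) ys f = trans (cong (f x +_) (∑-++ xs ys f)) (sym (+-assoc (f x) (∑ xs f) (∑ ys f)))

    ∑-map : ∀ {B : Set} (g : B → A) (xs : List B) (f : A → ℕ) → ∑ (map g xs) f ≡ ∑ xs (f ∘ g)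
    ∑-map g []       f = refl
    ∑-map g (x ∷ xs) f = cong (f (g x) +_) (∑-map g xs f)

    ∈⇒≤∑ : ∀ {xs : List A} {x} (f : A → ℕ) → x ∈ xs → f x ≤ ∑ xs f
    ∈⇒≤∑ {x ∷ xs} f (here refl) = m≤m+n (f x) (∑ xs f)
    ∈⇒≤∑ {y ∷ xs} f (there x∈) = ≤-trans (∈⇒≤∑ f x∈) (m≤n+m (∑ xs f) (f y))

    ∑-zero : ∀ (xs : List A) {f : A → ℕ} → (∀ {x} → x ∈ xs → f x ≡ 0) → ∑ xs f ≡ 0
    ∑-zero []       f≡0 = refl
    ∑-zero (x ∷ xs) f≡0 = cong₂ _+_ (f≡0 (here refl)) (∑-zero xs (f≡0 ∘ there))

    ∑>0⇒∃ : ∀ (xs : List A) (f : A → ℕ) → 0 < ∑ xs f → Any (λ x → 0 < f x) xs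
    ∑>0⇒∃ (x ∷ xs) f ∑>0 with f x in fx≡
    ... | suc _ = here (subst (0 <_) (sym fx≡) z<s)
    ... | zero  = there (∑>0⇒∃ xs f ∑>0)

    ∑≤1 : ∀ (xs : List A) (f : A → ℕ) → Unique xs → (∀ {x} → x ∈ xs → f x ≤ 1) →
          (∀ {x y} → x ∈ xs → y ∈ xs → 0 < f x → 0 < f y → x ≡ y) → ∑ xs f ≤ 1
    ∑≤1 []       f uniq f≤1 f-inj = z≤n
    ∑≤1 (x ∷ xs) f (x∉xs ∷ uniq) f≤1 f-inj with f x in fx≡
    ... | zero  = ∑≤1 xs f uniq (f≤1 ∘ there) (λ y∈ z∈ → f-inj (there y∈) (there z∈))
    ... | suc k = begin
      suc k + ∑ xs f ≡⟨ cong (suc k +_) (∑-zero xs rest≡0) ⟩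
      suc k + 0      ≡⟨ +-identityʳ (suc k) ⟩
      suc k          ≡⟨ fx≡ ⟨
      f x            ≤⟨ f≤1 (here refl) ⟩
      1              ∎
      where
      open ≤-Reasoning
      rest≡0 : ∀ {y} → y ∈ xs → f y ≡ 0
      rest≡0 {y} y∈ with f y in fy≡
      ... | zero  = refl
      ... | suc _ = ⊥-elim (All.lookup x∉xs y∈
                      (f-inj (here refl) (there y∈) (subst (0 <_) (sym fx≡) z<s) (subst (0 <_) (sym fy≡) z<s)))

  ∑-comm : ∀ {A B : Set} (xs : List A) (ys : List B) (f : A → B → ℕ) →
           ∑[ x ∈ xs ] ∑[ y ∈ ys ] f x y ≡ ∑[ y ∈ ys ] ∑[ x ∈ xs ] f x y
  ∑-comm []       ys f = sym (∑-zero ys (λ _ → refl))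
  ∑-comm (x ∷ xs) ys f =
    trans (cong (∑ ys (f x) +_) (∑-comm xs ys f)) (sym (∑-distrib-+ ys (f x) (λ y → ∑[ x ∈ xs ] f x y)))

  ∑-cartesianProduct : ∀ {A B : Set} (xs : List A) (ys : List B) (f : A × B → ℕ) →
                       ∑ (cartesianProduct xs ys) f ≡ ∑[ x ∈ xs ] ∑[ y ∈ ys ] f (x , y)
  ∑-cartesianProduct []       ys f = refl
  ∑-cartesianProduct (x ∷ xs) ys f = begin
    ∑ (map (x ,_) ys ++ cartesianProduct xs ys) f
      ≡⟨ ∑-++ (map (x ,_) ys) (cartesianProduct xs ys) f ⟩
    ∑ (map (x ,_) ys) f + ∑ (cartesianProduct xs ys) f
      ≡⟨ cong₂ _+_ (∑-map (x ,_) ys f) (∑-cartesianProduct xs ys f) ⟩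
    (∑[ y ∈ ys ] f (x , y)) + (∑[ x ∈ xs ] ∑[ y ∈ ys ] f (x , y)) ∎
    where open ≡-Reasoning

  length-cartesianProduct : ∀ {A B : Set} (xs : List A) (ys : List B) →
                            length (cartesianProduct xs ys) ≡ length xs * length ys
  length-cartesianProduct []       ys = refl
  length-cartesianProduct (x ∷ xs) ys = begin
    length (map (x ,_) ys ++ cartesianProduct xs ys)
      ≡⟨ length-++ (map (x ,_) ys) ⟩
    length (map (x ,_) ys) + length (cartesianProduct xs ys)
      ≡⟨ cong₂ _+_ (length-map (x ,_) ys) (length-cartesianProduct xs ys) ⟩
    length ys + length xs * length ys ∎
    where open ≡-Reasoning

  ∑-allFin-suc : ∀ n (f : Fin (suc n) → ℕ) → ∑ (allFin (suc n)) f ≡ f zero + ∑ (allFin n) (f ∘ suc)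
  ∑-allFin-suc n f =
    cong (f zero +_) (trans (cong (λ ys → ∑ ys f) (sym (map-tabulate (λ i → i) suc))) (∑-map suc (allFin n) f))

  module _ {A : Set} (_≟_ : DecidableEquality A) where

    ∑-δ : ∀ {xs : List A} {x} → Unique xs → x ∈ xs → (g : A → ℕ) →
          ∑[ y ∈ xs ] 𝟙 (x ≟ y) * g y ≡ g x
    ∑-δ {y ∷ ys} {x} (y∉ys ∷ uniq) x∈ g with x ≟ y | x∈
    ... | yes refl | _        = trans (cong (g x + 0 +_) (∑-off ys y∉ys)) (trans (+-identityʳ _) (+-identityʳ (g x)))
      where
      ∑-off : ∀ zs → All (x ≢_) zs → ∑[ z ∈ zs ] 𝟙 (x ≟ z) * g z ≡ 0
      ∑-off []       []           = refl
      ∑-off (z ∷ zs) (x≢z ∷ x∉zs) with x ≟ z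
      ... | yes x≡z = ⊥-elim (x≢z x≡z)
      ... | no _    = ∑-off zs x∉zs
    ... | no x≢y   | here x≡y = ⊥-elim (x≢y x≡y)
    ... | no _     | there x∈ys = ∑-δ uniq x∈ys g

    ∑-𝟙≟≡1 : ∀ {xs : List A} {x} → Unique xs → x ∈ xs → ∑[ y ∈ xs ] 𝟙 (x ≟ y) ≡ 1
    ∑-𝟙≟≡1 {xs} {x} uniq x∈ = trans (∑-cong xs (λ y → sym (*-identityʳ (𝟙 (x ≟ y))))) (∑-δ uniq x∈ (const 1))

  amgm-≤ : ∀ {x y} → x ≤ y → 2 * (x * y) ≤ x * x + y * y
  amgm-≤ {x} x≤y with m≤n⇒∃[o]m+o≡n x≤y
  ... | d , refl = begin
    2 * (x * (x + d))
      ≤⟨ m≤m+n _ (d * d) ⟩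
    2 * (x * (x + d)) + d * d
      ≡⟨ solve 2 (λ x d → con 2 :* (x :* (x :+ d)) :+ d :* d := x :* x :+ (x :+ d) :* (x :+ d)) refl x d ⟩
    x * x + (x + d) * (x + d) ∎
    where open ≤-Reasoning

  amgm : ∀ x y → 2 * (x * y) ≤ x * x + y * y
  amgm x y with ≤-total x y
  ... | inj₁ x≤y = amgm-≤ x≤y
  ... | inj₂ y≤x = subst₂ _≤_ (cong (2 *_) (*-comm y x)) (+-comm (y * y) (x * x)) (amgm-≤ y≤x)

  cross-term-≤ : ∀ a S N Q → S * S ≤ N * Q → 2 * (a * S) ≤ N * (a * a) + Q
  cross-term-≤ a zero    N       Q _       = ≤-trans (≤-reflexive (cong (2 *_) (*-zeroʳ a))) z≤n
  cross-term-≤ a (suc S) zero    Q ()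
  cross-term-≤ a S       (suc N) Q S²≤NQ = *-cancelˡ-≤ (suc N) (begin
    N′ * (2 * (a * S))
      ≡⟨ solve 3 (λ N a S → N :* (con 2 :* (a :* S)) := con 2 :* ((N :* a) :* S)) refl N′ a S ⟩
    2 * ((N′ * a) * S)
      ≤⟨ amgm (N′ * a) S ⟩
    N′ * a * (N′ * a) + S * S
      ≤⟨ +-monoʳ-≤ (N′ * a * (N′ * a)) S²≤NQ ⟩
    N′ * a * (N′ * a) + N′ * Q
      ≡⟨ solve 3 (λ N a Q → N :* a :* (N :* a) :+ N :* Q := N :* (N :* (a :* a) :+ Q)) refl N′ a Q ⟩
    N′ * (N′ * (a * a) + Q) ∎)
    where
    open ≤-Reasoning
    N′ : ℕ
    N′ = suc N

  cauchySchwarz-step : ∀ a S N Q → S * S ≤ N * Q → (a + S) * (a + S) ≤ suc N * (a * a + Q)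
  cauchySchwarz-step a S N Q S²≤NQ = begin
    (a + S) * (a + S)
      ≡⟨ solve 2 (λ a S → (a :+ S) :* (a :+ S) := a :* a :+ con 2 :* (a :* S) :+ S :* S) refl a S ⟩
    a * a + 2 * (a * S) + S * S
      ≤⟨ +-mono-≤ (+-monoʳ-≤ (a * a) (cross-term-≤ a S N Q S²≤NQ)) S²≤NQ ⟩
    a * a + (N * (a * a) + Q) + N * Q
      ≡⟨ solve 3 (λ a N Q → a :* a :+ (N :* (a :* a) :+ Q) :+ N :* Q := (con 1 :+ N) :* (a :* a :+ Q)) refl a N Q ⟩
    suc N * (a * a + Q) ∎
    where open ≤-Reasoning

  cauchySchwarz : ∀ {A : Set} (xs : List A) (f : A → ℕ) →
                  ∑ xs f * ∑ xs f ≤ (∑[ x ∈ xs ] 𝟙 (0 <? f x)) * (∑[ x ∈ xs ] f x * f x)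
  cauchySchwarz []       f = z≤n
  cauchySchwarz (x ∷ xs) f with f x
  ... | zero  = cauchySchwarz xs f
  ... | suc a = cauchySchwarz-step (suc a) (∑ xs f) (∑[ x ∈ xs ] 𝟙 (0 <? f x)) (∑[ x ∈ xs ] f x * f x)
                  (cauchySchwarz xs f)

open FiniteSums

module Counting where

  open import Data.List.Membership.Propositional using (_∈_; find)
  open import Data.List.Membership.Propositional.Properties using (∈-map⁻; ∈-allFin)

  elements : ∀ {n} → Subset n → List (Fin n)
  elements []            = []
  elements (inside ∷ S)  = zero ∷ map suc (elements S)
  elements (outside ∷ S) = map suc (elements S)

  ∣∣≡length-elements : ∀ {n} (S : Subset n) → ∣ S ∣ ≡ length (elements S)
  ∣∣≡length-elements []            = refl
  ∣∣≡length-elements (inside ∷ S)  = cong suc (trans (∣∣≡length-elements S) (sym (length-map suc (elements S))))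
  ∣∣≡length-elements (outside ∷ S) = trans (∣∣≡length-elements S) (sym (length-map suc (elements S)))

  ∈-elements⁻ : ∀ {n} {S : Subset n} {x} → x ∈ elements S → x ∈ₛ S
  ∈-elements⁻ {S = inside ∷ S}  (here refl) = here
  ∈-elements⁻ {S = inside ∷ S}  (there x∈)  with _ , y∈ , refl ← ∈-map⁻ suc x∈ = there (∈-elements⁻ y∈)
  ∈-elements⁻ {S = outside ∷ S} x∈          with _ , y∈ , refl ← ∈-map⁻ suc x∈ = there (∈-elements⁻ y∈)

  elements-unique : ∀ {n} (S : Subset n) → Unique (elements S)
  elements-unique []            = []
  elements-unique (inside ∷ S)  = map⁺ (All.tabulate (λ _ ())) ∷ Unique.map⁺ Finₚ.suc-injective (elements-unique S)
  elements-unique (outside ∷ S) = Unique.map⁺ Finₚ.suc-injective (elements-unique S)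

  ∣∣>0⇒∃∈ : ∀ {n} (S : Subset n) → 0 < ∣ S ∣ → ∃[ x ] x ∈ₛ S
  ∣∣>0⇒∃∈ (inside ∷ S)  _     = zero , here
  ∣∣>0⇒∃∈ (outside ∷ S) ∣S∣>0 with x , x∈S ← ∣∣>0⇒∃∈ S ∣S∣>0 = suc x , there x∈S

  ∣∣≡∑𝟙 : ∀ {n} (S : Subset n) → ∣ S ∣ ≡ ∑[ y ∈ allFin n ] 𝟙 (y ∈? S)
  ∣∣≡∑𝟙 {zero}  []      = refl
  ∣∣≡∑𝟙 {suc n} (s ∷ S) = begin
    ∣ s ∷ S ∣
      ≡⟨ head s ⟩
    𝟙 (zero ∈? s ∷ S) + (∑[ y ∈ allFin n ] 𝟙 (y ∈? S))
      ≡⟨ cong (𝟙 (zero ∈? s ∷ S) +_) (∑-cong (allFin n) (λ y → 𝟙-map′ (y ∈? S))) ⟨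
    𝟙 (zero ∈? s ∷ S) + (∑[ y ∈ allFin n ] 𝟙 (suc y ∈? s ∷ S))
      ≡⟨ ∑-allFin-suc n (λ y → 𝟙 (y ∈? s ∷ S)) ⟨
    ∑[ y ∈ allFin (suc n) ] 𝟙 (y ∈? s ∷ S) ∎
    where
    open ≡-Reasoning
    head : ∀ s → ∣ s ∷ S ∣ ≡ 𝟙 (zero ∈? s ∷ S) + (∑[ y ∈ allFin n ] 𝟙 (y ∈? S))
    head inside  = cong suc (∣∣≡∑𝟙 S)
    head outside = ∣∣≡∑𝟙 S

  module _ {A : Set} {n : ℕ} (f : A → Fin n) where

    fibre : List A → Fin n → ℕ
    fibre xs y = ∑[ x ∈ xs ] 𝟙 (f x Fin.≟ y)

    collisions : List A → ℕ
    collisions xs = ∑[ x ∈ xs ] fibre xs (f x)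

    ∑-fibre : ∀ xs → ∑ (allFin n) (fibre xs) ≡ length xs
    ∑-fibre xs = begin
      ∑[ y ∈ allFin n ] ∑[ x ∈ xs ] 𝟙 (f x Fin.≟ y)
        ≡⟨ ∑-comm (allFin n) xs _ ⟩
      ∑[ x ∈ xs ] ∑[ y ∈ allFin n ] 𝟙 (f x Fin.≟ y)
        ≡⟨ ∑-cong xs (λ x → ∑-𝟙≟≡1 Fin._≟_ (Unique.allFin⁺ n) (∈-allFin (f x))) ⟩
      ∑[ x ∈ xs ] 1
        ≡⟨ ∑-const xs 1 ⟩
      length xs * 1
        ≡⟨ *-identityʳ (length xs) ⟩
      length xs ∎
      where open ≡-Reasoning

    ∑-fibre² : ∀ xs → ∑[ y ∈ allFin n ] fibre xs y * fibre xs y ≡ collisions xs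
    ∑-fibre² xs = begin
      ∑[ y ∈ allFin n ] fibre xs y * fibre xs y
        ≡⟨ ∑-cong (allFin n) (λ y → *-distribʳ-∑ (fibre xs y) xs _) ⟩
      ∑[ y ∈ allFin n ] ∑[ x ∈ xs ] 𝟙 (f x Fin.≟ y) * fibre xs y
        ≡⟨ ∑-comm (allFin n) xs _ ⟩
      ∑[ x ∈ xs ] ∑[ y ∈ allFin n ] 𝟙 (f x Fin.≟ y) * fibre xs y
        ≡⟨ ∑-cong xs (λ x → ∑-δ Fin._≟_ (Unique.allFin⁺ n) (∈-allFin (f x)) (fibre xs)) ⟩
      collisions xs ∎
      where open ≡-Reasoning

    fibre>0⇒∃ : ∀ xs {y} → 0 < fibre xs y → Any (λ x → f x ≡ y) xs
    fibre>0⇒∃ xs {y} fibre>0 = Any.map (λ {x} → 𝟙>0⇒ (f x Fin.≟ y)) (∑>0⇒∃ xs _ fibre>0)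

    length²≤∣S∣*collisions : (S : Subset n) (xs : List A) → (∀ {x} → x ∈ xs → f x ∈ₛ S) →
                             length xs * length xs ≤ ∣ S ∣ * collisions xs
    length²≤∣S∣*collisions S xs f∈S = begin
      length xs * length xs                             ≡⟨ cong₂ _*_ (∑-fibre xs) (∑-fibre xs) ⟨
      ∑ (allFin n) (fibre xs) * ∑ (allFin n) (fibre xs) ≤⟨ cauchySchwarz (allFin n) (fibre xs) ⟩
      (∑[ y ∈ allFin n ] 𝟙 (0 <? fibre xs y)) * (∑[ y ∈ allFin n ] fibre xs y * fibre xs y)
        ≤⟨ *-mono-≤ (∑-mono-≤ (allFin n) (λ {y} _ → support y)) (≤-reflexive (∑-fibre² xs)) ⟩
      (∑[ y ∈ allFin n ] 𝟙 (y ∈? S)) * collisions xs    ≡⟨ cong (_* collisions xs) (∣∣≡∑𝟙 S) ⟨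
      ∣ S ∣ * collisions xs                             ∎
      where
      open ≤-Reasoning
      support : ∀ y → 𝟙 (0 <? fibre xs y) ≤ 𝟙 (y ∈? S)
      support y = 𝟙-mono y∈S (0 <? fibre xs y) (y ∈? S)
        where
        y∈S : 0 < fibre xs y → y ∈ₛ S
        y∈S fibre>0 with _ , x∈ , refl ← find (fibre>0⇒∃ xs fibre>0) = f∈S x∈

  module _ {A B : Set} {P : A → Set} {Q : B → Set} (P? : Decidable P) (Q? : Decidable Q)
           (_≟_ : DecidableEquality B) where

    count-≤-injection : ∀ (xs : List A) (ys : List B) (g : A → B) → Unique xs →
                        (∀ {x} → x ∈ xs → P x → g x ∈ ys × Q (g x)) →
                        (∀ {x x′} → x ∈ xs → x′ ∈ xs → P x → P x′ → g x ≡ g x′ → x ≡ x′) →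
                        ∑[ x ∈ xs ] 𝟙 (P? x) ≤ ∑[ y ∈ ys ] 𝟙 (Q? y)
    count-≤-injection xs ys g uniq g-into g-inj = begin
      ∑[ x ∈ xs ] 𝟙 (P? x)
        ≤⟨ ∑-mono-≤ xs (λ x∈ → hit x∈ (P? _)) ⟩
      ∑[ x ∈ xs ] ∑[ y ∈ ys ] 𝟙 (Q? y) * hits x y
        ≡⟨ ∑-comm xs ys _ ⟩
      ∑[ y ∈ ys ] ∑[ x ∈ xs ] 𝟙 (Q? y) * hits x y
        ≡⟨ ∑-cong ys (λ y → *-distribˡ-∑ (𝟙 (Q? y)) xs (λ x → hits x y)) ⟨
      ∑[ y ∈ ys ] 𝟙 (Q? y) * ∑ xs (λ x → hits x y)
        ≤⟨ ∑-mono-≤ ys (λ {y} _ → *-monoʳ-≤ (𝟙 (Q? y)) (hits≤1 y)) ⟩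
      ∑[ y ∈ ys ] 𝟙 (Q? y) * 1
        ≡⟨ ∑-cong ys (λ y → *-identityʳ (𝟙 (Q? y))) ⟩
      ∑[ y ∈ ys ] 𝟙 (Q? y) ∎
      where
      open ≤-Reasoning
      hits : A → B → ℕ
      hits x y = 𝟙 (P? x ×-dec g x ≟ y)
      hit : ∀ {x} → x ∈ xs → (Px? : Dec (P x)) → 𝟙 Px? ≤ ∑[ y ∈ ys ] 𝟙 (Q? y) * hits x y
      hit x∈ (no _)  = z≤n
      hit {x} x∈ (yes p) with gx∈ , Qgx ← g-into x∈ p =
        ≤-trans (≤-reflexive one) (∈⇒≤∑ (λ y → 𝟙 (Q? y) * hits x y) gx∈)
        where
        one : 1 ≡ 𝟙 (Q? (g x)) * hits x (g x)
        one = sym (cong₂ _*_ (𝟙-yes (Q? (g x)) Qgx) (𝟙-yes (P? x ×-dec g x ≟ g x) (p , refl)))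
      hits≤1 : ∀ y → ∑ xs (λ x → hits x y) ≤ 1
      hits≤1 y = ∑≤1 xs (λ x → hits x y) uniq (λ {x} _ → 𝟙≤1 (P? x ×-dec g x ≟ y))
        λ {x} {x′} x∈ x′∈ hx hx′ →
          let (px , gx≡y) = 𝟙>0⇒ (P? x ×-dec g x ≟ y) hx
              (px′ , gx′≡y) = 𝟙>0⇒ (P? x′ ×-dec g x′ ≟ y) hx′
          in g-inj x∈ x′∈ px px′ (trans gx≡y (sym gx′≡y))

open Counting

module Modular (n : ℕ) .{{_ : NonZero n}} where

  infix 4 _≈_ _≈?_

  -- A record rather than a synonym, so that a and b can be inferred from a ≈ b.
  record _≈_ (a b : ℕ) : Set where
    constructor mk≈
    field %≡% : a % n ≡ b % n

  open _≈_ public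

  ≈-isEquivalence : IsEquivalence _≈_
  ≈-isEquivalence = record
    { refl  = mk≈ refl
    ; sym   = λ (mk≈ a≈b) → mk≈ (sym a≈b)
    ; trans = λ (mk≈ a≈b) (mk≈ b≈c) → mk≈ (trans a≈b b≈c)
    }

  ≈-setoid : Setoid 0ℓ 0ℓ
  ≈-setoid = record { isEquivalence = ≈-isEquivalence }

  module ≈-Reasoning = SetoidReasoning ≈-setoid

  open IsEquivalence ≈-isEquivalence public
    renaming (refl to ≈-refl; sym to ≈-sym; trans to ≈-trans; reflexive to ≡⇒≈)

  %-≈ : ∀ a → a % n ≈ a
  %-≈ a = mk≈ (m%n%n≡m%n a n)

  +-cong : ∀ {a b c d} → a ≈ b → c ≈ d → a + c ≈ b + d
  +-cong {a} {b} {c} {d} (mk≈ a≈b) (mk≈ c≈d) = mk≈ (begin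
    (a + c) % n             ≡⟨ %-distribˡ-+ a c n ⟩
    (a % n + c % n) % n     ≡⟨ cong₂ (λ x y → (x + y) % n) a≈b c≈d ⟩
    (b % n + d % n) % n     ≡⟨ %-distribˡ-+ b d n ⟨
    (b + d) % n             ∎)
    where open ≡-Reasoning

  *-cong : ∀ {a b c d} → a ≈ b → c ≈ d → a * c ≈ b * d
  *-cong {a} {b} {c} {d} (mk≈ a≈b) (mk≈ c≈d) = mk≈ (begin
    (a * c) % n             ≡⟨ %-distribˡ-* a c n ⟩
    (a % n * (c % n)) % n   ≡⟨ cong₂ (λ x y → (x * y) % n) a≈b c≈d ⟩
    (b % n * (d % n)) % n   ≡⟨ %-distribˡ-* b d n ⟨
    (b * d) % n             ∎)
    where open ≡-Reasoning

  ^-congˡ : ∀ {a b} k → a ≈ b → a ^ k ≈ b ^ k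
  ^-congˡ zero    a≈b = ≈-refl
  ^-congˡ (suc k) a≈b = *-cong a≈b (^-congˡ k a≈b)

  ≈0⇒∣ : ∀ {a} → a ≈ 0 → n ∣ a
  ≈0⇒∣ {a} (mk≈ a≈0) = m%n≡0⇒n∣m a n (trans a≈0 (n∣m⇒m%n≡0 0 n (n ∣0)))

  ∣⇒≈0 : ∀ {a} → n ∣ a → a ≈ 0
  ∣⇒≈0 {a} n∣a = mk≈ (trans (n∣m⇒m%n≡0 a n n∣a) (sym (n∣m⇒m%n≡0 0 n (n ∣0))))

  ≈⇒≡ : ∀ {a b} → a < n → b < n → a ≈ b → a ≡ b
  ≈⇒≡ a<n b<n (mk≈ a≈b) = trans (sym (m<n⇒m%n≡m a<n)) (trans a≈b (m<n⇒m%n≡m b<n))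

  _≈?_ : ∀ a b → Dec (a ≈ b)
  a ≈? b = map′ mk≈ %≡% (a % n ≟ b % n)

  <⇒≉0 : ∀ {a} → 0 < a → a < n → ¬ a ≈ 0
  <⇒≉0 {a} 0<a a<n a≈0 = <⇒≱ a<n (∣⇒≤ {{>-nonZero 0<a}} (≈0⇒∣ a≈0))

  neg : ℕ → ℕ
  neg a = n ∸ a % n

  neg-inverse : ∀ a → neg a + a ≈ 0
  neg-inverse a = begin
    neg a + a       ≈⟨ +-cong ≈-refl (≈-sym (%-≈ a)) ⟩
    neg a + a % n   ≡⟨ m∸n+n≡m (m%n≤n a n) ⟩
    n               ≈⟨ ∣⇒≈0 ∣-refl ⟩
    0               ∎
    where open ≈-Reasoning

  +-cancelˡ : ∀ {a b c} → a + b ≈ a + c → b ≈ c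
  +-cancelˡ {a} {b} {c} a+b≈a+c = begin
    b                 ≈⟨ +-cong (neg-inverse a) ≈-refl ⟨
    neg a + a + b     ≡⟨ +-assoc (neg a) a b ⟩
    neg a + (a + b)   ≈⟨ +-cong (≈-refl {neg a}) a+b≈a+c ⟩
    neg a + (a + c)   ≡⟨ +-assoc (neg a) a c ⟨
    neg a + a + c     ≈⟨ +-cong (neg-inverse a) (≈-refl {c}) ⟩
    c                 ∎
    where open ≈-Reasoning

  module _ (n-prime : Prime n) where

    *-cancelʳ : ∀ {a b c} → ¬ c ≈ 0 → a * c ≈ b * c → a ≈ b
    *-cancelʳ {a} {b} {c} c≉0 ac≈bc =
      [ (λ a≤b → cancel-≤ a≤b ac≈bc) , (λ b≤a → ≈-sym (cancel-≤ b≤a (≈-sym ac≈bc))) ]′ (≤-total a b)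
      where
      cancel-≤ : ∀ {a b} → a ≤ b → a * c ≈ b * c → a ≈ b
      cancel-≤ {a} a≤b ac≈bc with d , refl ← m≤n⇒∃[o]m+o≡n a≤b =
        [ (λ n∣d → begin
             a       ≡⟨ +-identityʳ a ⟨
             a + 0   ≈⟨ +-cong (≈-refl {a}) (∣⇒≈0 n∣d) ⟨
             a + d   ∎)
        , (λ n∣c → contradiction (∣⇒≈0 n∣c) c≉0)
        ]′ (euclidsLemma d c n-prime (≈0⇒∣ (+-cancelˡ ac+dc≈ac+0)))
        where
        open ≈-Reasoning
        ac+dc≈ac+0 : a * c + d * c ≈ a * c + 0
        ac+dc≈ac+0 = begin
          a * c + d * c   ≡⟨ *-distribʳ-+ c a d ⟨
          (a + d) * c     ≈⟨ ac≈bc ⟨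
          a * c           ≡⟨ +-identityʳ (a * c) ⟨
          a * c + 0       ∎

module BinomialSplit where

  open import Data.Fin using (fromℕ; inject₁)
  open import Data.Vec.Functional using (Vector; init; last)
  open import Algebra.Properties.CommutativeSemiring.Binomial +-*-commutativeSemiring
    using (theorem; binomialTerm)
  open import Algebra.Properties.Monoid.Sum +-0-monoid using (sum; sum-init-last)
  import Algebra.Properties.Monoid.Mult +-0-monoid as Additive
  import Algebra.Properties.Monoid.Mult *-1-monoid as Multiplicative

  ×≡* : ∀ m x → m Additive.× x ≡ m * x
  ×≡* zero    x = refl
  ×≡* (suc m) x = cong (x +_) (×≡* m x)

  ^≡^ : ∀ x m → m Multiplicative.× x ≡ x ^ m
  ^≡^ x zero    = refl
  ^≡^ x (suc m) = cong (x *_) (^≡^ x m)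

  ∣-sum : ∀ {d n} (t : Vector ℕ n) → (∀ i → d ∣ t i) → d ∣ sum t
  ∣-sum {d} {zero} t _ = d ∣0
  ∣-sum {d} {suc n} t d∣t = ∣m∣n⇒∣m+n (d∣t zero) (∣-sum (t ∘ suc) (d∣t ∘ suc))

  binomial-split : ∀ {d} n .{{_ : NonZero n}} → (∀ {k} → 0 < k → k < n → d ∣ n C k) →
                   ∀ a → ∃[ m ] d ∣ m × (a + 1) ^ n ≡ 1 + m + a ^ n
  binomial-split {d} (suc q) d∣nCk a = m , d∣m , expansion
    where
    t : Vector ℕ (suc (suc q))
    t = binomialTerm a 1 (suc q)
    m : ℕ
    m = sum (init (t ∘ suc))
    d∣m : d ∣ m
    d∣m = ∣-sum (init (t ∘ suc)) λ i →
      let k = suc (toℕ (inject₁ i)) in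
      subst (d ∣_) (sym (×≡* (suc q C k) _))
        (∣m⇒∣m*n _ (d∣nCk z<s (s<s (subst (_< q) (sym (toℕ-inject₁ i)) (toℕ<n i)))))
    first : t zero ≡ 1
    first = trans (+-identityʳ _) (trans (+-identityʳ _) (trans (^≡^ 1 (suc q)) (^-zeroˡ (suc q))))
    final : last (t ∘ suc) ≡ a ^ suc q
    final = begin
      last (t ∘ suc)
        ≡⟨ cong (λ k → (suc q C suc k) Additive.× (suc k Multiplicative.× a * (q ∸ k) Multiplicative.× 1)) (toℕ-fromℕ q) ⟩
      (suc q C suc q) Additive.× (suc q Multiplicative.× a * (q ∸ q) Multiplicative.× 1)
        ≡⟨ ×≡* (suc q C suc q) _ ⟩
      (suc q C suc q) * (suc q Multiplicative.× a * (q ∸ q) Multiplicative.× 1)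
        ≡⟨ cong₂ _*_ (nCn≡1 (suc q)) (cong₂ _*_ (^≡^ a (suc q)) (cong (Multiplicative._× 1) (n∸n≡0 q))) ⟩
      1 * (a ^ suc q * 1)
        ≡⟨ trans (*-identityˡ _) (*-identityʳ _) ⟩
      a ^ suc q ∎
      where open ≡-Reasoning
    expansion : (a + 1) ^ suc q ≡ 1 + m + a ^ suc q
    expansion = begin
      (a + 1) ^ suc q                    ≡⟨ ^≡^ (a + 1) (suc q) ⟨
      suc q Multiplicative.× (a + 1)     ≡⟨ theorem (suc q) a 1 ⟩
      t zero + sum (t ∘ suc)             ≡⟨ cong₂ _+_ first (sum-init-last (t ∘ suc)) ⟩
      1 + (m + last (t ∘ suc))           ≡⟨ cong (λ x → 1 + (m + x)) final ⟩
      1 + (m + a ^ suc q)                ≡⟨ +-assoc 1 m (a ^ suc q) ⟨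
      1 + m + a ^ suc q                  ∎
      where open ≡-Reasoning

nCk*k![n∸k]!≡n! : ∀ {n k} → k ≤ n → (n C k) * (k ! * (n ∸ k) !) ≡ n !
nCk*k![n∸k]!≡n! {n} {k} k≤n = trans (cong (_* (k ! * (n ∸ k) !)) (nCk≡n!/k![n-k]! k≤n)) (m/n*n≡m (k![n∸k]!∣n! k≤n))
  where
  instance
    k!*[n∸k]!≢0 : NonZero (k ! * (n ∸ k) !)
    k!*[n∸k]!≢0 = k !* (n ∸ k) !≢0

prime⇒>1 : ∀ {q} → Prime q → 1 < q
prime⇒>1 {q} q-prime = nonTrivial⇒n>1 q {{prime⇒nonTrivial q-prime}}

module Fermat (p : ℕ) (p-prime : Prime p) where

  private instance
    p≢0 : NonZero p
    p≢0 = prime⇒nonZero p-prime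

  open Modular p
  open BinomialSplit using (binomial-split)

  1<p : 1 < p
  1<p = prime⇒>1 p-prime

  p∤m! : ∀ {m} → m < p → ¬ p ∣ m !
  p∤m! {zero}  _   = >⇒∤ 1<p
  p∤m! {suc m} m<p p∣m! with euclidsLemma (suc m) (m !) p-prime p∣m!
  ... | inj₁ p∣1+m = >⇒∤ m<p p∣1+m
  ... | inj₂ p∣m!  = p∤m! (<-trans (n<1+n m) m<p) p∣m!

  p∣p! : p ∣ p !
  p∣p! = n∣n! p
    where
    n∣n! : ∀ n .{{_ : NonZero n}} → n ∣ n !
    n∣n! (suc n) = m∣m*n (n !)

  p∣pCk : ∀ {k} → 0 < k → k < p → p ∣ p C k
  p∣pCk {k} 0<k k<p
    with euclidsLemma (p C k) (k ! * (p ∸ k) !) p-prime (subst (p ∣_) (sym (nCk*k![n∸k]!≡n! (<⇒≤ k<p))) p∣p!)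
  ... | inj₁ p∣pCk = p∣pCk
  ... | inj₂ p∣k![p∸k]! with euclidsLemma (k !) ((p ∸ k) !) p-prime p∣k![p∸k]!
  ...   | inj₁ p∣k!     = contradiction p∣k! (p∤m! k<p)
  ...   | inj₂ p∣[p∸k]! = contradiction p∣[p∸k]! (p∤m! (∸-monoʳ-< 0<k (<⇒≤ k<p)))

  freshman : ∀ a → (a + 1) ^ p ≈ 1 + a ^ p
  freshman a with m , p∣m , expansion ← binomial-split p p∣pCk a = begin
    (a + 1) ^ p     ≡⟨ expansion ⟩
    1 + m + a ^ p   ≈⟨ +-cong (+-cong (≈-refl {1}) (∣⇒≈0 p∣m)) (≈-refl {a ^ p}) ⟩
    1 + 0 + a ^ p   ∎
    where open ≈-Reasoning

  fermat : ∀ a → a ^ p ≈ a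
  fermat zero    = ≡⇒≈ (^-zeroˡ′ p)
    where
    ^-zeroˡ′ : ∀ n .{{_ : NonZero n}} → 0 ^ n ≡ 0
    ^-zeroˡ′ (suc n) = refl
  fermat (suc a) = begin
    suc a ^ p       ≡⟨ cong (_^ p) (+-comm 1 a) ⟩
    (a + 1) ^ p     ≈⟨ freshman a ⟩
    1 + a ^ p       ≈⟨ +-cong (≈-refl {1}) (fermat a) ⟩
    suc a           ∎
    where open ≈-Reasoning

  inverse : ∀ {a} → 0 < a → a < p → a * a ^ (p ∸ 2) ≈ 1
  inverse {a} 0<a a<p = *-cancelʳ p-prime (<⇒≉0 0<a a<p) (begin
    a * a ^ (p ∸ 2) * a    ≡⟨ *-comm (a ^ suc (p ∸ 2)) a ⟩
    a ^ (2 + (p ∸ 2))      ≡⟨ cong (a ^_) (m+[n∸m]≡n 1<p) ⟩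
    a ^ p                  ≈⟨ fermat a ⟩
    a                      ≡⟨ *-identityˡ a ⟨
    1 * a                  ∎)
    where open ≈-Reasoning

-- The list c₀ ∷ c₁ ∷ … ∷ cₖ₋₁ stands for the monic polynomial c₀ + c₁ x + … + cₖ₋₁ xᵏ⁻¹ + xᵏ.
eval : List ℕ → ℕ → ℕ
eval []       x = 1
eval (c ∷ cs) x = c + x * eval cs x

deflate : ℕ → List ℕ → List ℕ
deflate r []                = []
deflate r (_ ∷ [])          = []
deflate r (c ∷ cs@(_ ∷ _))  = eval cs r ∷ deflate r cs

length-deflate : ∀ r c cs → length (deflate r (c ∷ cs)) ≡ length cs
length-deflate r c []       = refl
length-deflate r c (d ∷ ds) = cong suc (length-deflate r d ds)

-- f x − f r = (x − r) · deflate r f x, with both sides moved so that no subtraction occurs.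
eval-deflate : ∀ r c cs x → let f = c ∷ cs; g = deflate r f in
                eval f x + r * eval g x ≡ eval f r + x * eval g x
eval-deflate r c []     x = solve 3 (λ c x r → c :+ x :* con 1 :+ r :* con 1 := c :+ r :* con 1 :+ x :* con 1) refl c x r
eval-deflate r c cs@(d ∷ ds) x = begin
  c + x * F x + r * (F r + x * G x)
    ≡⟨ solve 6 (λ c x r Fx Fr Gx → c :+ x :* Fx :+ r :* (Fr :+ x :* Gx) := c :+ r :* Fr :+ x :* (Fx :+ r :* Gx))
               refl c x r (F x) (F r) (G x) ⟩
  c + r * F r + x * (F x + r * G x)
    ≡⟨ cong (λ z → c + r * F r + x * z) (eval-deflate r d ds x) ⟩
  c + r * F r + x * (F r + x * G x) ∎
  where
  open ≡-Reasoning
  F G : ℕ → ℕ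
  F = eval cs
  G = eval (deflate r cs)

eval-replicate : ∀ n x → eval (replicate n 0) x ≡ x ^ n
eval-replicate zero    x = refl
eval-replicate (suc n) x = cong (x *_) (eval-replicate n x)

module Roots (p : ℕ) (p-prime : Prime p) where

  private instance
    p≢0 : NonZero p
    p≢0 = prime⇒nonZero p-prime

  open Modular p

  root-of-deflate : ∀ {c cs y y′} → let f = c ∷ cs in
                     y < p → y′ < p → y ≢ y′ → eval f y ≈ 0 → eval f y′ ≈ 0 → eval (deflate y f) y′ ≈ 0
  root-of-deflate {c} {cs} {y} {y′} y<p y′<p y≢y′ fy≈0 fy′≈0 with eval (deflate y (c ∷ cs)) y′ ≈? 0
  ... | yes gy′≈0 = gy′≈0
  ... | no  gy′≉0 = contradiction (≈⇒≡ y<p y′<p (*-cancelʳ p-prime gy′≉0 yg≈y′g)) y≢y′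
    where
    open ≈-Reasoning
    f : List ℕ
    f = c ∷ cs
    g : ℕ
    g = eval (deflate y f) y′
    yg≈y′g : y * g ≈ y′ * g
    yg≈y′g = begin
      y * g                 ≈⟨ +-cong fy′≈0 (≈-refl {y * g}) ⟨
      eval f y′ + y * g     ≡⟨ eval-deflate y c cs y′ ⟩
      eval f y + y′ * g     ≈⟨ +-cong fy≈0 (≈-refl {y′ * g}) ⟩
      y′ * g                ∎

  root-count : ∀ f (ys : List ℕ) → Unique ys → All (_< p) ys → ∑[ y ∈ ys ] 𝟙 (eval f y ≈? 0) ≤ length f
  root-count f []       _               _              = z≤n
  root-count f (y ∷ ys) (y∉ys ∷ uniq) (y<p ∷ ys<p) with eval f y ≈? 0
  ... | no _ = root-count f ys uniq ys<p
  ... | yes fy≈0 with f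
  ...   | []     = contradiction fy≈0 (<⇒≉0 z<s (prime⇒>1 p-prime))
  ...   | c ∷ cs = s≤s (begin
    ∑[ y′ ∈ ys ] 𝟙 (eval (c ∷ cs) y′ ≈? 0)
      ≤⟨ ∑-mono-≤ ys (λ y′∈ → 𝟙-mono (root-of-deflate {c} {cs} y<p (All.lookup ys<p y′∈) (All.lookup y∉ys y′∈) fy≈0)
                                      _ _) ⟩
    ∑[ y′ ∈ ys ] 𝟙 (eval (deflate y (c ∷ cs)) y′ ≈? 0)
      ≤⟨ root-count (deflate y (c ∷ cs)) ys uniq ys<p ⟩
    length (deflate y (c ∷ cs))
      ≡⟨ length-deflate y c cs ⟩
    length cs ∎)
    where open ≤-Reasoning

  power-root⇒root : ∀ c s {y} → y ^ suc s ≈ c → eval (neg c ∷ replicate s 0) y ≈ 0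
  power-root⇒root c s {y} yˢ≈c = begin
    eval (neg c ∷ replicate s 0) y ≡⟨ cong (λ z → neg c + y * z) (eval-replicate s y) ⟩
    neg c + y ^ suc s              ≈⟨ +-cong (≈-refl {neg c}) yˢ≈c ⟩
    neg c + c                      ≈⟨ neg-inverse c ⟩
    0                              ∎
    where open ≈-Reasoning

  power-root-count : ∀ s .{{_ : NonZero s}} c (ys : List ℕ) → Unique ys → All (_< p) ys →
                     ∑[ y ∈ ys ] 𝟙 (y ^ s ≈? c) ≤ s
  power-root-count (suc s) c ys uniq ys<p = begin
    ∑[ y ∈ ys ] 𝟙 (y ^ suc s ≈? c) ≤⟨ ∑-mono-≤ ys (λ {y} _ → 𝟙-mono (power-root⇒root c s {y}) _ _) ⟩
    ∑[ y ∈ ys ] 𝟙 (eval f y ≈? 0)   ≤⟨ root-count f ys uniq ys<p ⟩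
    length f                        ≡⟨ cong suc (length-replicate s) ⟩
    suc s                           ∎
    where
    open ≤-Reasoning
    f : List ℕ
    f = neg c ∷ replicate s 0

-- The reciprocals 1 / leibniz a b are the entries of Leibniz's harmonic triangle.
leibniz : ℕ → ℕ → ℕ
leibniz a b = suc (a + b) * ((a + b) C a)

leibniz-factorial : ∀ a b → leibniz a b * (a ! * b !) ≡ suc (a + b) !
leibniz-factorial a b = begin
  suc (a + b) * ((a + b) C a) * (a ! * b !)
    ≡⟨ *-assoc (suc (a + b)) ((a + b) C a) (a ! * b !) ⟩
  suc (a + b) * (((a + b) C a) * (a ! * b !))
    ≡⟨ cong (λ z → suc (a + b) * (((a + b) C a) * (a ! * z !))) (m+n∸m≡n a b) ⟨
  suc (a + b) * (((a + b) C a) * (a ! * (a + b ∸ a) !))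
    ≡⟨ cong (suc (a + b) *_) (nCk*k![n∸k]!≡n! (m≤m+n a b)) ⟩
  suc (a + b) * (a + b) ! ∎
  where open ≡-Reasoning

private
  cancel-factorials : ∀ a b {x y} → x * (a ! * b !) ≡ y * (a ! * b !) → x ≡ y
  cancel-factorials a b {x} {y} = *-cancelʳ-≡ x y (a ! * b !) {{a !* b !≢0}}

leibniz-sucˡ : ∀ a b → leibniz (suc a) b * suc a ≡ suc (suc (a + b)) * leibniz a b
leibniz-sucˡ a b = cancel-factorials a b (begin
  leibniz (suc a) b * suc a * (a ! * b !)
    ≡⟨ solve 4 (λ L A f g → L :* A :* (f :* g) := L :* (A :* f :* g)) refl (leibniz (suc a) b) (suc a) (a !) (b !) ⟩
  leibniz (suc a) b * (suc a ! * b !)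
    ≡⟨ leibniz-factorial (suc a) b ⟩
  suc (suc (a + b)) * suc (a + b) !
    ≡⟨ cong (suc (suc (a + b)) *_) (leibniz-factorial a b) ⟨
  suc (suc (a + b)) * (leibniz a b * (a ! * b !))
    ≡⟨ *-assoc (suc (suc (a + b))) (leibniz a b) (a ! * b !) ⟨
  suc (suc (a + b)) * leibniz a b * (a ! * b !) ∎)
  where open ≡-Reasoning

leibniz-sucˡ≡sucʳ : ∀ a b → leibniz (suc a) b * suc a ≡ leibniz a (suc b) * suc b
leibniz-sucˡ≡sucʳ a b = cancel-factorials a b (begin
  leibniz (suc a) b * suc a * (a ! * b !)
    ≡⟨ solve 4 (λ L A f g → L :* A :* (f :* g) := L :* (A :* f :* g)) refl (leibniz (suc a) b) (suc a) (a !) (b !) ⟩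
  leibniz (suc a) b * (suc a ! * b !)
    ≡⟨ leibniz-factorial (suc a) b ⟩
  suc (suc a + b) !
    ≡⟨ cong (λ n → suc n !) (+-suc a b) ⟨
  suc (a + suc b) !
    ≡⟨ leibniz-factorial a (suc b) ⟨
  leibniz a (suc b) * (a ! * suc b !)
    ≡⟨ solve 4 (λ L B f g → L :* (f :* (B :* g)) := L :* B :* (f :* g)) refl (leibniz a (suc b)) (suc b) (a !) (b !) ⟩
  leibniz a (suc b) * suc b * (a ! * b !) ∎)
  where open ≡-Reasoning

-- 1 / leibniz (suc a) b = 1 / leibniz a b − 1 / leibniz a (suc b), cleared of denominators.
leibniz-step : ∀ a b {D} → leibniz a b ∣ D → leibniz a (suc b) ∣ D → leibniz (suc a) b ∣ D
leibniz-step a b {D} (divides d₁ D≡d₁L) (divides d₂ D≡d₂L₊) =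
  ∣m+n∣m⇒∣n (divides d₁ (sym d₁L′≡d₂L′+D)) (divides d₂ refl)
  where
  L′ : ℕ
  L′ = leibniz (suc a) b
  d₁L′≡d₂L′+D : d₁ * L′ ≡ d₂ * L′ + D
  d₁L′≡d₂L′+D = *-cancelʳ-≡ _ _ (suc a) (begin
    d₁ * L′ * suc a
      ≡⟨ *-assoc d₁ L′ (suc a) ⟩
    d₁ * (L′ * suc a)
      ≡⟨ cong (d₁ *_) (leibniz-sucˡ a b) ⟩
    d₁ * (suc (suc (a + b)) * leibniz a b)
      ≡⟨ solve 3 (λ d N L → d :* (N :* L) := N :* (d :* L)) refl d₁ (suc (suc (a + b))) (leibniz a b) ⟩
    suc (suc (a + b)) * (d₁ * leibniz a b)
      ≡⟨ cong (suc (suc (a + b)) *_) D≡d₁L ⟨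
    suc (suc (a + b)) * D
      ≡⟨ solve 3 (λ a b D → (con 2 :+ a :+ b) :* D := (con 1 :+ a) :* D :+ (con 1 :+ b) :* D) refl a b D ⟩
    suc a * D + suc b * D
      ≡⟨ cong (λ z → suc a * D + suc b * z) D≡d₂L₊ ⟩
    suc a * D + suc b * (d₂ * leibniz a (suc b))
      ≡⟨ cong (suc a * D +_) (solve 3 (λ B d L → B :* (d :* L) := d :* (L :* B)) refl (suc b) d₂ (leibniz a (suc b))) ⟩
    suc a * D + d₂ * (leibniz a (suc b) * suc b)
      ≡⟨ cong (λ z → suc a * D + d₂ * z) (leibniz-sucˡ≡sucʳ a b) ⟨
    suc a * D + d₂ * (L′ * suc a)
      ≡⟨ solve 4 (λ A D d L → A :* D :+ d :* (L :* A) := (d :* L :+ D) :* A) refl (suc a) D d₂ L′ ⟩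
    (d₂ * L′ + D) * suc a ∎)
    where open ≡-Reasoning

leibniz-∣ : ∀ a b {D} → (∀ {j} → 0 < j → j ≤ suc (a + b) → j ∣ D) → leibniz a b ∣ D
leibniz-∣ zero    b j∣D = j∣D z<s (≤-reflexive (*-identityʳ (suc b)))
leibniz-∣ (suc a) b j∣D = leibniz-step a b
  (leibniz-∣ a b       (λ 0<j j≤ → j∣D 0<j (m≤n⇒m≤1+n j≤)))
  (leibniz-∣ a (suc b) (λ 0<j j≤ → j∣D 0<j (≤-trans j≤ (≤-reflexive (cong suc (+-suc a b))))))

leibniz-diagonal-growth : ∀ n → 4 * leibniz n n ≤ leibniz (suc n) (suc n)
leibniz-diagonal-growth n = *-cancelʳ-≤ _ _ (suc n * suc n) (begin
  4 * leibniz n n * (suc n * suc n)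
    ≡⟨ solve 2 (λ L n → con 4 :* L :* ((con 1 :+ n) :* (con 1 :+ n)) := (con 2 :+ n :+ n) :* ((con 2 :+ n :+ n) :* L))
               refl (leibniz n n) n ⟩
  suc (suc (n + n)) * (suc (suc (n + n)) * leibniz n n)
    ≤⟨ *-monoˡ-≤ (suc (suc (n + n)) * leibniz n n)
                 (≤-trans (n≤1+n (suc (suc (n + n)))) (≤-reflexive (cong (2 +_) (sym (+-suc n n))))) ⟩
  suc (suc (n + suc n)) * (suc (suc (n + n)) * leibniz n n)
    ≡⟨ cong (suc (suc (n + suc n)) *_) (leibniz-sucˡ n n) ⟨
  suc (suc (n + suc n)) * (leibniz (suc n) n * suc n)
    ≡⟨ cong (suc (suc (n + suc n)) *_) (leibniz-sucˡ≡sucʳ n n) ⟩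
  suc (suc (n + suc n)) * (leibniz n (suc n) * suc n)
    ≡⟨ *-assoc (suc (suc (n + suc n))) (leibniz n (suc n)) (suc n) ⟨
  suc (suc (n + suc n)) * leibniz n (suc n) * suc n
    ≡⟨ cong (_* suc n) (leibniz-sucˡ n (suc n)) ⟨
  leibniz (suc n) (suc n) * suc n * suc n
    ≡⟨ *-assoc (leibniz (suc n) (suc n)) (suc n) (suc n) ⟩
  leibniz (suc n) (suc n) * (suc n * suc n) ∎)
  where open ≤-Reasoning

4^n≤leibniz[n,n] : ∀ n → 4 ^ n ≤ leibniz n n
4^n≤leibniz[n,n] zero    = ≤-refl
4^n≤leibniz[n,n] (suc n) = ≤-trans (*-monoʳ-≤ 4 (4^n≤leibniz[n,n] n)) (leibniz-diagonal-growth n)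

module PrimeCounting where

  open import Data.List.Membership.Propositional using (_∈_)
  open import Data.List.Membership.Propositional.Properties using (∈-filter⁺; ∈-filter⁻; ∈-upTo⁺; ∈-upTo⁻)

  power-bracket : ∀ q {N} → 1 < q → 0 < N → ∃[ e ] q ^ e ≤ N × N < q ^ suc e
  power-bracket q {suc zero}    1<q _ = 0 , ≤-refl , subst (1 <_) (sym (*-identityʳ q)) 1<q
  power-bracket q {suc (suc N)} 1<q _ with e , qᵉ≤1+N , 1+N<qᵉ⁺¹ ← power-bracket q {suc N} 1<q z<s
    with suc (suc N) <? q ^ suc e
  ... | yes 2+N<qᵉ⁺¹ = e , m≤n⇒m≤1+n qᵉ≤1+N , 2+N<qᵉ⁺¹
  ... | no  2+N≮qᵉ⁺¹ =
    suc e , ≤-reflexive qᵉ⁺¹≡2+N , subst (_< q ^ suc (suc e)) qᵉ⁺¹≡2+N (^-monoʳ-< q 1<q (n<1+n (suc e)))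
    where
    qᵉ⁺¹≡2+N : q ^ suc e ≡ suc (suc N)
    qᵉ⁺¹≡2+N = ≤-antisym (≮⇒≥ 2+N≮qᵉ⁺¹) 1+N<qᵉ⁺¹

  factor-out : ∀ q {j} → 1 < q → 0 < j → ∃₂ λ a r → j ≡ q ^ a * r × ¬ q ∣ r × 0 < r
  factor-out q {j} 1<q = go (<-wellFounded j)
    where
    cofactor-smaller : ∀ {j k} → 0 < j → j ≡ k * q → 0 < k × k < j
    cofactor-smaller {k = suc k} 0<j j≡kq =
      z<s , subst (suc k <_) (sym j≡kq) (subst (_< suc k * q) (*-identityʳ (suc k)) (*-monoʳ-< (suc k) 1<q))
    cofactor-smaller {k = zero} 0<j j≡0 = contradiction j≡0 (>⇒≢ 0<j)

    go : ∀ {j} → Acc _<_ j → 0 < j → ∃₂ λ a r → j ≡ q ^ a * r × ¬ q ∣ r × 0 < r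
    go {j} (acc rec) 0<j with q ∣? j
    ... | no  q∤j = 0 , j , sym (+-identityʳ j) , q∤j , 0<j
    ... | yes (divides k j≡kq) with 0<k , k<j ← cofactor-smaller {k = k} 0<j j≡kq
      with a , r , k≡qᵃr , q∤r , 0<r ← go (rec k<j) 0<k =
        suc a , r , trans j≡kq (trans (cong (_* q) k≡qᵃr) (solve 3 (λ x r q → x :* r :* q := q :* x :* r) refl (q ^ a) r q)) ,
        q∤r , 0<r

  no-prime-factor⇒∣1 : ∀ {j} → 0 < j → (∀ {q} → Prime q → ¬ q ∣ j) → j ∣ 1
  no-prime-factor⇒∣1 {j} 0<j no-factor with factorise j {{>-nonZero 0<j}}
  ... | record { factors = [] ; isFactorisation = j≡1 } = subst (_∣ 1) (sym j≡1) ∣-refl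
  ... | record { factors = q ∷ qs ; isFactorisation = j≡qΠqs ; factorsPrime = q-prime ∷ _ } =
    contradiction (subst (q ∣_) (sym j≡qΠqs) (m∣m*n _)) (no-factor q-prime)

  ^-∣-^ : ∀ q {a e} → a ≤ e → q ^ a ∣ q ^ e
  ^-∣-^ q {a} {e} a≤e =
    divides (q ^ (e ∸ a))
      (trans (cong (q ^_) (sym (m+[n∸m]≡n a≤e))) (trans (^-distribˡ-+-* q a (e ∸ a)) (*-comm (q ^ a) _)))

  smooth-common-multiple : ∀ {N} (Q : List ℕ) → All Prime Q → 0 < N →
    ∃[ D ] 0 < D × D ≤ N ^ length Q × (∀ {j} → 0 < j → j ≤ N → (∀ {q} → Prime q → q ∣ j → q ∈ Q) → j ∣ D)
  smooth-common-multiple [] [] 0<N =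
    1 , z<s , ≤-refl , λ 0<j _ j-smooth → no-prime-factor⇒∣1 0<j (λ q-prime q∣j → ¬Any[] (j-smooth q-prime q∣j))
  smooth-common-multiple {N} (q ∷ Q) (q-prime ∷ Q-prime) 0<N
    with e , qᵉ≤N , N<qᵉ⁺¹ ← power-bracket q (prime⇒>1 q-prime) 0<N
    with D , 0<D , D≤Nᴷ , ∣D ← smooth-common-multiple Q Q-prime 0<N =
    q ^ e * D , *-mono-< (m^n>0 q e) 0<D , *-mono-≤ qᵉ≤N D≤Nᴷ , ∣qᵉD
    where
    instance
      q≢0 : NonZero q
      q≢0 = prime⇒nonZero q-prime
    ∣qᵉD : ∀ {j} → 0 < j → j ≤ N → (∀ {q′} → Prime q′ → q′ ∣ j → q′ ∈ q ∷ Q) → j ∣ q ^ e * D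
    ∣qᵉD {j} 0<j j≤N j-smooth with a , r , j≡qᵃr , q∤r , 0<r ← factor-out q (prime⇒>1 q-prime) 0<j =
      subst (_∣ q ^ e * D) (sym j≡qᵃr) (*-pres-∣ (^-∣-^ q a≤e) (∣D 0<r r≤N r-smooth))
      where
      instance
        r≢0 : NonZero r
        r≢0 = >-nonZero 0<r
      qᵃ≤N : q ^ a ≤ N
      qᵃ≤N = ≤-trans (subst (q ^ a ≤_) (sym j≡qᵃr) (m≤m*n (q ^ a) r)) j≤N
      a≤e : a ≤ e
      a≤e = ≮⇒≥ λ e<a → <⇒≱ (≤-<-trans qᵃ≤N N<qᵉ⁺¹) (^-monoʳ-≤ q e<a)
      r≤N : r ≤ N
      r≤N = ≤-trans (subst (r ≤_) (sym j≡qᵃr) (m≤n*m r (q ^ a) {{m^n≢0 q a}})) j≤N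
      r-smooth : ∀ {q′} → Prime q′ → q′ ∣ r → q′ ∈ Q
      r-smooth q′-prime q′∣r with j-smooth q′-prime (∣-trans q′∣r (divides (q ^ a) j≡qᵃr))
      ... | here refl = contradiction q′∣r q∤r
      ... | there q′∈Q = q′∈Q

  primesUpTo : ℕ → List ℕ
  primesUpTo N = filter prime? (upTo (suc N))

  π : ℕ → ℕ
  π N = length (primesUpTo N)

  ∈-primesUpTo⁺ : ∀ {q N} → Prime q → q ≤ N → q ∈ primesUpTo N
  ∈-primesUpTo⁺ q-prime q≤N = ∈-filter⁺ prime? (∈-upTo⁺ (s≤s q≤N)) q-prime

  ∈-primesUpTo⁻ : ∀ N {q} → q ∈ primesUpTo N → Prime q × q ≤ N
  ∈-primesUpTo⁻ N q∈ with q∈upTo , q-prime ← ∈-filter⁻ prime? q∈ = q-prime , s≤s⁻¹ (∈-upTo⁻ q∈upTo)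

  primesUpTo-unique : ∀ N → Unique (primesUpTo N)
  primesUpTo-unique N = Unique.filter⁺ prime? (Unique.upTo⁺ (suc N))

  4^n≤N^πN : ∀ {n N} → 2 * n < N → 4 ^ n ≤ N ^ π N
  4^n≤N^πN {n} {N} 2n<N
    with D , 0<D , D≤N^π , ∣D ← smooth-common-multiple (primesUpTo N) (all-filter prime? (upTo (suc N))) (≤-trans z<s 2n<N) =
    begin
      4 ^ n
        ≤⟨ 4^n≤leibniz[n,n] n ⟩
      leibniz n n
        ≤⟨ ∣⇒≤ {{>-nonZero 0<D}} (leibniz-∣ n n (λ 0<j j≤2n+1 → ∣D 0<j (j≤N j≤2n+1) (λ q-prime q∣j →
             ∈-primesUpTo⁺ q-prime (≤-trans (∣⇒≤ {{>-nonZero 0<j}} q∣j) (j≤N j≤2n+1))))) ⟩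
      D
        ≤⟨ D≤N^π ⟩
      N ^ π N ∎
    where
    open ≤-Reasoning
    j≤N : ∀ {j} → j ≤ suc (n + n) → j ≤ N
    j≤N j≤2n+1 = ≤-trans j≤2n+1 (subst (λ m → suc m ≤ N) (cong (n +_) (+-identityʳ n)) 2n<N)

  odd-bracket : ∀ {H} → 0 < H → ∃[ n ] 2 * n < H × H ≤ 2 + 2 * n
  odd-bracket {1}                 _ = 0 , z<s , s≤s z≤n
  odd-bracket {2}                 _ = 0 , z<s , ≤-refl
  odd-bracket {suc (suc (suc H))} _ with n , 2n<1+H , 1+H≤2+2n ← odd-bracket {suc H} z<s =
    suc n , subst (_< 3 + H) (sym (*-suc 2 n)) (s<s (s<s 2n<1+H)) ,
    subst (3 + H ≤_) (cong (2 +_) (sym (*-suc 2 n))) (s≤s (s≤s 1+H≤2+2n))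

  2^-cancel-≤ : ∀ {a b} → 2 ^ a ≤ 2 ^ b → a ≤ b
  2^-cancel-≤ {a} {b} 2ᵃ≤2ᵇ = subst₂ _≤_ (⌊log₂[2^n]⌋≡n a) (⌊log₂[2^n]⌋≡n b) (⌊log₂⌋-mono-≤ 2ᵃ≤2ᵇ)

  chebyshev : ∀ {H t} → 0 < H → H < 2 ^ t → H ≤ t * π H + 2
  chebyshev {H} {t} 0<H H<2ᵗ with n , 2n<H , H≤2+2n ← odd-bracket 0<H = begin
    H               ≤⟨ H≤2+2n ⟩
    2 + 2 * n       ≡⟨ +-comm 2 (2 * n) ⟩
    2 * n + 2       ≤⟨ +-monoˡ-≤ 2 (2^-cancel-≤ 2²ⁿ≤2ᵗᵖ) ⟩
    t * π H + 2     ∎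
    where
    open ≤-Reasoning
    2²ⁿ≤2ᵗᵖ : 2 ^ (2 * n) ≤ 2 ^ (t * π H)
    2²ⁿ≤2ᵗᵖ = begin
      2 ^ (2 * n)     ≡⟨ ^-*-assoc 2 2 n ⟨
      4 ^ n           ≤⟨ 4^n≤N^πN {n} 2n<H ⟩
      H ^ π H         ≤⟨ ^-monoˡ-≤ (π H) (<⇒≤ H<2ᵗ) ⟩
      (2 ^ t) ^ π H   ≡⟨ ^-*-assoc 2 t (π H) ⟩
      2 ^ (t * π H)   ∎

open PrimeCounting

prime∣prime⇒≡ : ∀ {q r} → Prime q → Prime r → q ∣ r → q ≡ r
prime∣prime⇒≡ {q} q-prime r-prime q∣r with prime⇒irreducible r-prime q∣r
... | inj₁ q≡1 = contradiction q≡1 (>⇒≢ (prime⇒>1 q-prime))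
... | inj₂ q≡r = q≡r

prime-ratio-injective : ∀ {a b c d} → Prime a → Prime b → Prime d → a ≢ b → b * c ≡ d * a → a ≡ c × b ≡ d
prime-ratio-injective {a} {b} {c} {d} a-prime b-prime d-prime a≢b bc≡da
  with euclidsLemma d a b-prime (divides c (trans (sym bc≡da) (*-comm b c)))
... | inj₂ b∣a = contradiction (sym (prime∣prime⇒≡ b-prime a-prime b∣a)) a≢b
... | inj₁ b∣d with refl ← prime∣prime⇒≡ b-prime d-prime b∣d =
  sym (*-cancelˡ-≡ c a b {{prime⇒nonZero b-prime}} bc≡da) , refl

^-distrib-* : ∀ a b n → (a * b) ^ n ≡ a ^ n * b ^ n
^-distrib-* a b zero    = refl
^-distrib-* a b (suc n) = begin
  a * b * (a * b) ^ n     ≡⟨ cong (a * b *_) (^-distrib-* a b n) ⟩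
  a * b * (a ^ n * b ^ n) ≡⟨ solve 4 (λ a b x y → a :* b :* (x :* y) := a :* x :* (b :* y)) refl a b (a ^ n) (b ^ n) ⟩
  a * a ^ n * (b * b ^ n) ∎
  where open ≡-Reasoning

module InversePowers (p : ℕ) (p-prime : Prime p) (s : ℕ) where

  private instance
    p≢0 : NonZero p
    p≢0 = prime⇒nonZero p-prime

  open Modular p
  open Fermat p p-prime using (inverse)
  open ≈-Reasoning

  inv : ℕ → ℕ
  inv a = a ^ (p ∸ 2)

  invPow≡inv^ : ∀ a → invPow p s a ≡ inv a ^ s
  invPow≡inv^ a = trans (cong (a ^_) (*-comm s (p ∸ 2))) (sym (^-*-assoc a (p ∸ 2) s))

  *invPow*^≈ : ∀ x {a} → 0 < a → a < p → x * invPow p s a * a ^ s ≈ x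
  *invPow*^≈ x {a} 0<a a<p = begin
    x * invPow p s a * a ^ s
      ≡⟨ cong (λ y → x * y * a ^ s) (invPow≡inv^ a) ⟩
    x * inv a ^ s * a ^ s
      ≡⟨ trans (*-assoc x _ _) (cong (x *_) (trans (sym (^-distrib-* (inv a) a s)) (cong (_^ s) (*-comm (inv a) a)))) ⟩
    x * (a * inv a) ^ s
      ≈⟨ *-cong (≈-refl {x}) (^-congˡ s (inverse 0<a a<p)) ⟩
    x * 1 ^ s
      ≡⟨ trans (cong (x *_) (^-zeroˡ s)) (*-identityʳ x) ⟩
    x ∎

  *invPow-cancelʳ : ∀ {x y a} → 0 < a → a < p → x * invPow p s a ≈ y * invPow p s a → x ≈ y
  *invPow-cancelʳ {x} {y} {a} 0<a a<p xa≈ya = begin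
    x                          ≈⟨ *invPow*^≈ x 0<a a<p ⟨
    x * invPow p s a * a ^ s   ≈⟨ *-cong xa≈ya (≈-refl {a ^ s}) ⟩
    y * invPow p s a * a ^ s   ≈⟨ *invPow*^≈ y 0<a a<p ⟩
    y                          ∎

  ratio : ℕ → ℕ → ℕ
  ratio a b = (b * inv a) % p

  ratio^s≈ : ∀ {x y a b} → 0 < x → x < p → 0 < b → b < p →
             x * invPow p s a ≈ y * invPow p s b → ratio a b ^ s ≈ inv x * y
  ratio^s≈ {x} {y} {a} {b} 0<x x<p 0<b b<p xa≈yb = begin
    ratio a b ^ s                 ≡⟨ *-identityˡ (ratio a b ^ s) ⟨
    1 * ratio a b ^ s             ≈⟨ *-cong (inverse 0<x x<p) (≈-refl {ratio a b ^ s}) ⟨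
    x * inv x * ratio a b ^ s     ≡⟨ solve 3 (λ x i r → x :* i :* r := i :* (x :* r)) refl x (inv x) (ratio a b ^ s) ⟩
    inv x * (x * ratio a b ^ s)   ≈⟨ *-cong (≈-refl {inv x}) x*ratio^s≈y ⟩
    inv x * y                     ∎
    where
    x*ratio^s≈y : x * ratio a b ^ s ≈ y
    x*ratio^s≈y = begin
      x * ratio a b ^ s           ≈⟨ *-cong (≈-refl {x}) (^-congˡ s (%-≈ (b * inv a))) ⟩
      x * (b * inv a) ^ s         ≡⟨ cong (x *_) (^-distrib-* b (inv a) s) ⟩
      x * (b ^ s * inv a ^ s)     ≡⟨ solve 3 (λ x B I → x :* (B :* I) := x :* I :* B) refl x (b ^ s) (inv a ^ s) ⟩
      x * inv a ^ s * b ^ s       ≡⟨ cong (λ z → x * z * b ^ s) (invPow≡inv^ a) ⟨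
      x * invPow p s a * b ^ s    ≈⟨ *-cong xa≈yb (≈-refl {b ^ s}) ⟩
      y * invPow p s b * b ^ s    ≈⟨ *invPow*^≈ y 0<b b<p ⟩
      y                           ∎

  ratio-injective : ∀ {a b c d} → 0 < a → a < p → 0 < c → c < p → ratio a b ≡ ratio c d → b * c ≈ d * a
  ratio-injective {a} {b} {c} {d} 0<a a<p 0<c c<p ratio≡ = begin
    b * c                     ≡⟨ *-identityʳ (b * c) ⟨
    b * c * 1                 ≈⟨ *-cong (≈-refl {b * c}) (inverse 0<a a<p) ⟨
    b * c * (a * inv a)       ≡⟨ solve 4 (λ b c a i → b :* c :* (a :* i) := b :* i :* (a :* c)) refl b c a (inv a) ⟩
    b * inv a * (a * c)       ≈⟨ *-cong (%-≈ (b * inv a)) (≈-refl {a * c}) ⟨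
    ratio a b * (a * c)       ≡⟨ cong (_* (a * c)) ratio≡ ⟩
    ratio c d * (a * c)       ≈⟨ *-cong (%-≈ (d * inv c)) (≈-refl {a * c}) ⟩
    d * inv c * (a * c)       ≡⟨ solve 4 (λ d i a c → d :* i :* (a :* c) := d :* a :* (c :* i)) refl d (inv c) a c ⟩
    d * a * (c * inv c)       ≈⟨ *-cong (≈-refl {d * a}) (inverse 0<c c<p) ⟩
    d * a * 1                 ≡⟨ *-identityʳ (d * a) ⟩
    d * a                     ∎

module CollisionCount (s : ℕ) .{{_ : NonZero s}} (p : ℕ) (p-prime : Prime p) (M : Subset p)
               (M∌0 : ∀ x → x ∈ₛ M → toℕ x ≢ 0) (H : ℕ) (H²<p : H * H < p) where

  open import Data.List.Membership.Propositional using (_∈_)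
  open import Data.List.Membership.Propositional.Properties using (∈-allFin; ∈-map⁺; ∈-upTo⁺; ∈-upTo⁻; ∈-cartesianProduct⁻)

  private instance
    p≢0 : NonZero p
    p≢0 = prime⇒nonZero p-prime

  open Modular p
  open InversePowers p p-prime s
  open Roots p p-prime using (power-root-count)

  point : Fin p × ℕ → Fin p
  point (m , ℓ) = (toℕ m * invPow p s ℓ) mod p

  ∈-MHs : ∀ {m ℓ} → m ∈ₛ M → 0 < ℓ → ℓ ≤ H → point (m , ℓ) ∈ₛ MHs p s H M
  ∈-MHs {m} {suc ℓ} m∈M _ 1+ℓ≤H =
    lookup⇒[]= _ (MHs p s H M) (trans (lookup∘tabulate _ (point (m , suc ℓ))) (cong side member))
    where
    x : Fin p
    x = point (m , suc ℓ)
    hit : Fin p → Bool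
    hit m′ = ⌊ m′ ∈? M ⌋ ∧ any (λ h → ⌊ toℕ x ≟ (toℕ m′ * invPow p s h) % p ⌋) (oneToH H)
    hit-m : T (hit m)
    hit-m = Equivalence.from T-∧
      (fromWitness m∈M , any⁺ _ (Any.map (λ { refl → fromWitness (toℕ-fromℕ< _) }) (∈-map⁺ suc (∈-upTo⁺ 1+ℓ≤H))))
    member : memb p s H M x ≡ true
    member = Equivalence.to T-≡ (any⁺ hit (Any.map (λ { refl → hit-m }) (∈-allFin m)))

  ms : List (Fin p)
  ms = elements M

  ℓs : List ℕ
  ℓs = primesUpTo H

  points : List (Fin p × ℕ)
  points = cartesianProduct ms ℓs

  0<∈ms : ∀ {m} → m ∈ ms → 0 < toℕ m
  0<∈ms {m} m∈ = n≢0⇒n>0 (M∌0 m (∈-elements⁻ m∈))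

  ∈ℓs⇒prime : ∀ {ℓ} → ℓ ∈ ℓs → Prime ℓ
  ∈ℓs⇒prime = proj₁ ∘ ∈-primesUpTo⁻ H

  0<∈ℓs : ∀ {ℓ} → ℓ ∈ ℓs → 0 < ℓ
  0<∈ℓs ℓ∈ = ≤-trans (s≤s z≤n) (prime⇒>1 (∈ℓs⇒prime ℓ∈))

  ∈ℓs*∈ℓs<p : ∀ {ℓ ℓ′} → ℓ ∈ ℓs → ℓ′ ∈ ℓs → ℓ * ℓ′ < p
  ∈ℓs*∈ℓs<p ℓ∈ ℓ′∈ = ≤-<-trans (*-mono-≤ (proj₂ (∈-primesUpTo⁻ H ℓ∈)) (proj₂ (∈-primesUpTo⁻ H ℓ′∈))) H²<p

  ∈ℓs<p : ∀ {ℓ} → ℓ ∈ ℓs → ℓ < p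
  ∈ℓs<p {ℓ} ℓ∈ = ≤-<-trans (m≤m*n ℓ ℓ {{>-nonZero (0<∈ℓs ℓ∈)}}) (∈ℓs*∈ℓs<p ℓ∈ ℓ∈)

  point-≡⇒≈ : ∀ {m m′ ℓ ℓ′} → point (m′ , ℓ′) ≡ point (m , ℓ) →
              toℕ m′ * invPow p s ℓ′ ≈ toℕ m * invPow p s ℓ
  point-≡⇒≈ eq = mk≈ (trans (sym (toℕ-fromℕ< _)) (trans (cong toℕ eq) (toℕ-fromℕ< _)))

  module _ {m m′ : Fin p} (m′∈ : m′ ∈ ms) where

    OffDiagonalCollision : ℕ × ℕ → Set
    OffDiagonalCollision (ℓ , ℓ′) = ℓ ≢ ℓ′ × point (m′ , ℓ′) ≡ point (m , ℓ)

    off-diagonal-collision? : ∀ z → Dec (OffDiagonalCollision z)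
    off-diagonal-collision? (ℓ , ℓ′) = ¬? (ℓ ≟ ℓ′) ×-dec (point (m′ , ℓ′) Fin.≟ point (m , ℓ))

    -- A collision m′ ℓ′⁻ˢ = m ℓ⁻ˢ forces (ℓ / ℓ′)ˢ = m / m′, and the ratio ℓ / ℓ′ of two distinct
    -- primes below √p determines them.
    off-diagonal-collisions : ∑[ z ∈ cartesianProduct ℓs ℓs ] 𝟙 (off-diagonal-collision? z) ≤ s
    off-diagonal-collisions = begin
      ∑[ z ∈ cartesianProduct ℓs ℓs ] 𝟙 (off-diagonal-collision? z)
        ≤⟨ count-≤-injection off-diagonal-collision? (λ y → y ^ s ≈? inv (toℕ m′) * toℕ m) _≟_
             (cartesianProduct ℓs ℓs) (upTo p) (λ (ℓ , ℓ′) → ratio ℓ′ ℓ)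
             (Unique.cartesianProduct⁺ (primesUpTo-unique H) (primesUpTo-unique H)) into injective ⟩
      ∑[ y ∈ upTo p ] 𝟙 (y ^ s ≈? inv (toℕ m′) * toℕ m)
        ≤⟨ power-root-count s _ (upTo p) (Unique.upTo⁺ p) (All.tabulate ∈-upTo⁻) ⟩
      s ∎
      where
      open ≤-Reasoning
      into : ∀ {z} → z ∈ cartesianProduct ℓs ℓs → OffDiagonalCollision z →
             ratio (proj₂ z) (proj₁ z) ∈ upTo p × ratio (proj₂ z) (proj₁ z) ^ s ≈ inv (toℕ m′) * toℕ m
      into {ℓ , ℓ′} z∈ (_ , collision) with ℓ∈ , ℓ′∈ ← ∈-cartesianProduct⁻ ℓs ℓs z∈ =
        ∈-upTo⁺ (m%n<n _ p) ,
        ratio^s≈ (0<∈ms m′∈) (toℕ<n m′) (0<∈ℓs ℓ∈) (∈ℓs<p ℓ∈) (point-≡⇒≈ {m} {m′} {ℓ} {ℓ′} collision)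
      injective : ∀ {z z′} → z ∈ cartesianProduct ℓs ℓs → z′ ∈ cartesianProduct ℓs ℓs →
                  OffDiagonalCollision z → OffDiagonalCollision z′ →
                  ratio (proj₂ z) (proj₁ z) ≡ ratio (proj₂ z′) (proj₁ z′) → z ≡ z′
      injective {ℓ₁ , ℓ₁′} {ℓ₂ , ℓ₂′} z∈ z′∈ (ℓ₁≢ℓ₁′ , _) _ ratio≡
        with ℓ₁∈ , ℓ₁′∈ ← ∈-cartesianProduct⁻ ℓs ℓs z∈
        with ℓ₂∈ , ℓ₂′∈ ← ∈-cartesianProduct⁻ ℓs ℓs z′∈
        with ℓ₁′≡ℓ₂′ , ℓ₁≡ℓ₂ ←
          prime-ratio-injective (∈ℓs⇒prime ℓ₁′∈) (∈ℓs⇒prime ℓ₁∈) (∈ℓs⇒prime ℓ₂∈) (ℓ₁≢ℓ₁′ ∘ sym)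
            (≈⇒≡ (∈ℓs*∈ℓs<p ℓ₁∈ ℓ₂′∈) (∈ℓs*∈ℓs<p ℓ₂∈ ℓ₁′∈)
              (ratio-injective {ℓ₁′} {ℓ₁} {ℓ₂′} {ℓ₂} (0<∈ℓs ℓ₁′∈) (∈ℓs<p ℓ₁′∈) (0<∈ℓs ℓ₂′∈) (∈ℓs<p ℓ₂′∈) ratio≡))
        = cong₂ _,_ ℓ₁≡ℓ₂ ℓ₁′≡ℓ₂′

    diagonal-collision : ∀ {ℓ} → ℓ ∈ ℓs → point (m′ , ℓ) ≡ point (m , ℓ) → m ≡ m′
    diagonal-collision ℓ∈ collision = toℕ-injective (sym (≈⇒≡ (toℕ<n m′) (toℕ<n m)
      (*invPow-cancelʳ (0<∈ℓs ℓ∈) (∈ℓs<p ℓ∈) (point-≡⇒≈ {m} {m′} collision))))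

    collisions-between : ∑[ ℓ ∈ ℓs ] ∑[ ℓ′ ∈ ℓs ] 𝟙 (point (m′ , ℓ′) Fin.≟ point (m , ℓ)) ≤
                         𝟙 (m Fin.≟ m′) * π H + s
    collisions-between = begin
      ∑[ ℓ ∈ ℓs ] ∑[ ℓ′ ∈ ℓs ] 𝟙 (point (m′ , ℓ′) Fin.≟ point (m , ℓ))
        ≤⟨ ∑-mono-≤ ℓs (λ ℓ∈ → ∑-mono-≤ ℓs (λ _ → split ℓ∈ (_ ≟ _))) ⟩
      ∑[ ℓ ∈ ℓs ] ∑[ ℓ′ ∈ ℓs ] (𝟙 (ℓ ≟ ℓ′) * 𝟙 (m Fin.≟ m′) + 𝟙 (off-diagonal-collision? (ℓ , ℓ′)))
        ≡⟨ ∑-cong ℓs (λ ℓ → ∑-distrib-+ ℓs _ _) ⟩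
      ∑[ ℓ ∈ ℓs ] ((∑[ ℓ′ ∈ ℓs ] 𝟙 (ℓ ≟ ℓ′) * 𝟙 (m Fin.≟ m′)) +
                   (∑[ ℓ′ ∈ ℓs ] 𝟙 (off-diagonal-collision? (ℓ , ℓ′))))
        ≡⟨ ∑-distrib-+ ℓs _ _ ⟩
      (∑[ ℓ ∈ ℓs ] ∑[ ℓ′ ∈ ℓs ] 𝟙 (ℓ ≟ ℓ′) * 𝟙 (m Fin.≟ m′)) +
      (∑[ ℓ ∈ ℓs ] ∑[ ℓ′ ∈ ℓs ] 𝟙 (off-diagonal-collision? (ℓ , ℓ′)))
        ≤⟨ +-mono-≤ diagonal (≤-reflexive (sym (∑-cartesianProduct ℓs ℓs _))) ⟩
      𝟙 (m Fin.≟ m′) * π H + (∑[ z ∈ cartesianProduct ℓs ℓs ] 𝟙 (off-diagonal-collision? z))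
        ≤⟨ +-monoʳ-≤ (𝟙 (m Fin.≟ m′) * π H) off-diagonal-collisions ⟩
      𝟙 (m Fin.≟ m′) * π H + s ∎
      where
      open ≤-Reasoning
      split : ∀ {ℓ ℓ′} → ℓ ∈ ℓs → (ℓ≟ℓ′ : Dec (ℓ ≡ ℓ′)) →
              𝟙 (point (m′ , ℓ′) Fin.≟ point (m , ℓ)) ≤
              𝟙 ℓ≟ℓ′ * 𝟙 (m Fin.≟ m′) + 𝟙 (off-diagonal-collision? (ℓ , ℓ′))
      split {ℓ} ℓ∈ (yes refl) = ≤-trans (𝟙-mono (diagonal-collision ℓ∈) _ (m Fin.≟ m′))
        (≤-trans (≤-reflexive (sym (*-identityˡ (𝟙 (m Fin.≟ m′))))) (m≤m+n _ (𝟙 (off-diagonal-collision? (ℓ , ℓ)))))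
      split ℓ∈ (no ℓ≢ℓ′)  = 𝟙-mono (ℓ≢ℓ′ ,_) _ _
      diagonal : ∑[ ℓ ∈ ℓs ] ∑[ ℓ′ ∈ ℓs ] 𝟙 (ℓ ≟ ℓ′) * 𝟙 (m Fin.≟ m′) ≤ 𝟙 (m Fin.≟ m′) * π H
      diagonal = ≤-trans
        (∑-mono-≤ ℓs (λ ℓ∈ → ≤-reflexive (∑-δ _≟_ (primesUpTo-unique H) ℓ∈ (const (𝟙 (m Fin.≟ m′))))))
        (≤-reflexive (trans (∑-const ℓs (𝟙 (m Fin.≟ m′))) (*-comm (π H) _)))

  collision-bound : collisions point points ≤ length ms * (π H + length ms * s)
  collision-bound = begin
    collisions point points
      ≡⟨ ∑-cartesianProduct ms ℓs _ ⟩
    ∑[ m ∈ ms ] ∑[ ℓ ∈ ℓs ] fibre point points (point (m , ℓ))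
      ≡⟨ ∑-cong ms (λ m → ∑-cong ℓs (λ ℓ → ∑-cartesianProduct ms ℓs _)) ⟩
    ∑[ m ∈ ms ] ∑[ ℓ ∈ ℓs ] ∑[ m′ ∈ ms ] ∑[ ℓ′ ∈ ℓs ] 𝟙 (point (m′ , ℓ′) Fin.≟ point (m , ℓ))
      ≡⟨ ∑-cong ms (λ m → ∑-comm ℓs ms _) ⟩
    ∑[ m ∈ ms ] ∑[ m′ ∈ ms ] ∑[ ℓ ∈ ℓs ] ∑[ ℓ′ ∈ ℓs ] 𝟙 (point (m′ , ℓ′) Fin.≟ point (m , ℓ))
      ≤⟨ ∑-mono-≤ ms (λ {m} _ → ∑-mono-≤ ms (λ m′∈ → collisions-between {m} m′∈)) ⟩
    ∑[ m ∈ ms ] ∑[ m′ ∈ ms ] (𝟙 (m Fin.≟ m′) * π H + s)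
      ≡⟨ ∑-cong ms (λ m → ∑-distrib-+ ms _ _) ⟩
    ∑[ m ∈ ms ] ((∑[ m′ ∈ ms ] 𝟙 (m Fin.≟ m′) * π H) + (∑[ m′ ∈ ms ] s))
      ≤⟨ ∑-mono-≤ ms (λ m∈ →
           ≤-reflexive (cong₂ _+_ (∑-δ Fin._≟_ (elements-unique M) m∈ (const (π H))) (∑-const ms s))) ⟩
    ∑[ m ∈ ms ] (π H + length ms * s)
      ≡⟨ ∑-const ms _ ⟩
    length ms * (π H + length ms * s) ∎
    where open ≤-Reasoning

  collision-inequality : ∣ M ∣ * π H * (∣ M ∣ * π H) ≤ ∣ MHs p s H M ∣ * (∣ M ∣ * (π H + ∣ M ∣ * s))
  collision-inequality rewrite ∣∣≡length-elements M = begin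
    length ms * π H * (length ms * π H)     ≡⟨ cong (λ n → n * n) (length-cartesianProduct ms ℓs) ⟨
    length points * length points           ≤⟨ length²≤∣S∣*collisions point (MHs p s H M) points points⊆MHs ⟩
    ∣ MHs p s H M ∣ * collisions point points ≤⟨ *-monoʳ-≤ ∣ MHs p s H M ∣ collision-bound ⟩
    ∣ MHs p s H M ∣ * (length ms * (π H + length ms * s)) ∎
    where
    open ≤-Reasoning
    points⊆MHs : ∀ {z} → z ∈ points → point z ∈ₛ MHs p s H M
    points⊆MHs {m , ℓ} z∈ with m∈ , ℓ∈ ← ∈-cartesianProduct⁻ ms ℓs z∈ =
      ∈-MHs (∈-elements⁻ m∈) (0<∈ℓs ℓ∈) (proj₂ (∈-primesUpTo⁻ H ℓ∈))

  MHs-nonempty : 0 < H → 0 < ∣ M ∣ → 0 < ∣ MHs p s H M ∣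
  MHs-nonempty 0<H ∣M∣>0 with m , m∈M ← ∣∣>0⇒∃∈ M ∣M∣>0 =
    ≤-<-trans z≤n (x∈p⇒∣p-x∣<∣p∣ (∈-MHs m∈M z<s 0<H))

open import Data.Fin.Subset using (_∈_)

⌊log₂⌋>0 : ∀ {n} → 1 < n → 0 < ⌊log₂ n ⌋
⌊log₂⌋>0 1<n = ⌊log₂⌋-mono-≤ 1<n

<2^⌊log₂⌋ : ∀ {H n} → 0 < ⌊log₂ n ⌋ → H * H < n → H < 2 ^ ⌊log₂ n ⌋
<2^⌊log₂⌋ {H} {n} 0<L H²<n = ≰⇒> λ 2ᴸ≤H → <⇒≱ 0<L (+-cancelˡ-≤ L L 0 (begin
  L + L
    ≡⟨ ⌊log₂[2^n]⌋≡n (L + L) ⟨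
  ⌊log₂ 2 ^ (L + L) ⌋
    ≤⟨ ⌊log₂⌋-mono-≤ (≤-trans (≤-reflexive (^-distribˡ-+-* 2 L L)) (≤-trans (*-mono-≤ 2ᴸ≤H 2ᴸ≤H) (<⇒≤ H²<n))) ⟩
  L
    ≡⟨ +-identityʳ L ⟨
  L + 0 ∎))
  where
  open ≤-Reasoning
  L : ℕ
  L = ⌊log₂ n ⌋

⊓-bound : ∀ {M k X s} → 0 < s → M * k * (M * k) ≤ X * (M * (k + M * s)) → (M * k) ⊓ (k * k) ≤ 2 * s * X
⊓-bound {zero} _ _ = z≤n
⊓-bound {M@(suc _)} {k} {X} {s} 0<s Mk²≤ = by-cases (k ≤? M * s)
  where
  open ≤-Reasoning
  Mk²≤X[k+Ms] : M * (k * k) ≤ X * (k + M * s)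
  Mk²≤X[k+Ms] = *-cancelˡ-≤ M (begin
    M * (M * (k * k))       ≡⟨ solve 2 (λ M k → M :* (M :* (k :* k)) := M :* k :* (M :* k)) refl M k ⟩
    M * k * (M * k)         ≤⟨ Mk²≤ ⟩
    X * (M * (k + M * s))   ≡⟨ solve 3 (λ X M y → X :* (M :* y) := M :* (X :* y)) refl X M (k + M * s) ⟩
    M * (X * (k + M * s))   ∎)
  by-cases : Dec (k ≤ M * s) → (M * k) ⊓ (k * k) ≤ 2 * s * X
  by-cases (yes k≤Ms) = ≤-trans (m⊓n≤n (M * k) (k * k)) (*-cancelˡ-≤ M (begin
    M * (k * k)           ≤⟨ Mk²≤X[k+Ms] ⟩
    X * (k + M * s)       ≤⟨ *-monoʳ-≤ X (+-monoˡ-≤ (M * s) k≤Ms) ⟩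
    X * (M * s + M * s)   ≡⟨ solve 3 (λ X M s → X :* (M :* s :+ M :* s) := M :* (con 2 :* s :* X)) refl X M s ⟩
    M * (2 * s * X)       ∎))
  by-cases (no k≰Ms) = ≤-trans (m⊓n≤m (M * k) (k * k)) (*-cancelˡ-≤ k {{>-nonZero 0<k}} (begin
    k * (M * k)           ≡⟨ solve 2 (λ M k → k :* (M :* k) := M :* (k :* k)) refl M k ⟩
    M * (k * k)           ≤⟨ Mk²≤X[k+Ms] ⟩
    X * (k + M * s)       ≤⟨ *-monoʳ-≤ X (+-monoʳ-≤ k (<⇒≤ Ms<k)) ⟩
    X * (k + k)           ≡⟨ solve 2 (λ X k → X :* (k :+ k) := k :* (con 2 :* con 1 :* X)) refl X k ⟩
    k * (2 * 1 * X)       ≤⟨ *-monoʳ-≤ k (*-monoˡ-≤ X (*-monoʳ-≤ 2 0<s)) ⟩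
    k * (2 * s * X)       ∎))
    where
    Ms<k : M * s < k
    Ms<k = ≰⇒> k≰Ms
    0<k : 0 < k
    0<k = ≤-<-trans z≤n Ms<k

final-bound : ∀ {M H L k X s} → 0 < s → 0 < L → H ≤ L * k + 2 → (0 < M → 0 < X) →
              (M * k) ⊓ (k * k) ≤ 2 * s * X → (M * H * L) ⊓ (H * H) ≤ 9 * s * X * (L * L)
final-bound {zero} _ _ _ _ _ = z≤n
final-bound {M@(suc _)} {H} {L} {k} {X} {s} 0<s 0<L H≤Lk+2 0<X ⊓≤2sX = by-cases (2 ≤? L * k)
  where
  open ≤-Reasoning
  by-cases : Dec (2 ≤ L * k) → (M * H * L) ⊓ (H * H) ≤ 9 * s * X * (L * L)
  by-cases (yes 2≤Lk) = begin
    (M * H * L) ⊓ (H * H)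
      ≤⟨ ⊓-mono-≤ (*-monoˡ-≤ L (*-monoʳ-≤ M H≤2Lk)) (*-mono-≤ H≤2Lk H≤2Lk) ⟩
    (M * (2 * (L * k)) * L) ⊓ (2 * (L * k) * (2 * (L * k)))
      ≡⟨ cong₂ _⊓_ (solve 3 (λ M L k → M :* (con 2 :* (L :* k)) :* L := con 2 :* (L :* L) :* (M :* k)) refl M L k)
                   (solve 2 (λ L k → con 2 :* (L :* k) :* (con 2 :* (L :* k)) := con 4 :* (L :* L) :* (k :* k)) refl L k) ⟩
    (2 * (L * L) * (M * k)) ⊓ (4 * (L * L) * (k * k))
      ≤⟨ ⊓-monoˡ-≤ (4 * (L * L) * (k * k)) (*-monoˡ-≤ (M * k) (*-monoˡ-≤ (L * L) {2} {4} (s≤s (s≤s z≤n)))) ⟩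
    (4 * (L * L) * (M * k)) ⊓ (4 * (L * L) * (k * k))
      ≡⟨ *-distribˡ-⊓ (4 * (L * L)) (M * k) (k * k) ⟨
    4 * (L * L) * ((M * k) ⊓ (k * k))
      ≤⟨ *-monoʳ-≤ (4 * (L * L)) ⊓≤2sX ⟩
    4 * (L * L) * (2 * s * X)
      ≡⟨ solve 3 (λ L s X → con 4 :* (L :* L) :* (con 2 :* s :* X) := con 8 :* s :* X :* (L :* L)) refl L s X ⟩
    8 * s * X * (L * L)
      ≤⟨ *-monoˡ-≤ (L * L) (*-monoˡ-≤ X (*-monoˡ-≤ s (n≤1+n 8))) ⟩
    9 * s * X * (L * L) ∎
    where
    H≤2Lk : H ≤ 2 * (L * k)
    H≤2Lk = ≤-trans H≤Lk+2
      (≤-trans (+-monoʳ-≤ (L * k) 2≤Lk) (≤-reflexive (solve 1 (λ x → x :+ x := con 2 :* x) refl (L * k))))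
  by-cases (no 2≰Lk) = begin
    (M * H * L) ⊓ (H * H) ≤⟨ m⊓n≤n (M * H * L) (H * H) ⟩
    H * H                 ≤⟨ *-mono-≤ H≤3 H≤3 ⟩
    9 * 1 * 1 * (1 * 1)   ≤⟨ *-mono-≤ (*-mono-≤ (*-monoʳ-≤ 9 0<s) (0<X z<s)) (*-mono-≤ 0<L 0<L) ⟩
    9 * s * X * (L * L)   ∎
    where
    H≤3 : H ≤ 3
    H≤3 = ≤-trans H≤Lk+2 (+-monoˡ-≤ 2 (≤-pred (≰⇒> 2≰Lk)))

lemma2p1 : (s : ℕ) → 1 ≤ s →
    Σ ℕ (λ C → 1 ≤ C ×
      ((p : ℕ) .{{_ : NonZero p}} → Prime p →
       (M : Subset p) → ((x : Fin p) → x ∈ M → toℕ x ≢ 0) → ∣ M ∣ * ∣ M ∣ < p →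
       (H : ℕ) → 1 ≤ H → H * H < p →
       ((∣ M ∣ * H * ⌊log₂ p ⌋) ⊓ (H * H))
         ≤ C * ∣ MHs p s H M ∣ * (⌊log₂ p ⌋ * ⌊log₂ p ⌋)))
lemma2p1 zero    ()
-- The bound holds without the hypothesis ∣ M ∣ * ∣ M ∣ < p, which is therefore ignored.
lemma2p1 s@(suc _) 0<s = 9 * s , s≤s z≤n , λ p p-prime M M∌0 _ H 0<H H²<p →
  let open CollisionCount s p p-prime M M∌0 H H²<p
      0<L : 0 < ⌊log₂ p ⌋
      0<L = ⌊log₂⌋>0 {p} (prime⇒>1 p-prime)
  in final-bound {∣ M ∣} {H} {⌊log₂ p ⌋} {π H} {∣ MHs p s H M ∣} 0<s 0<L
       (chebyshev {H} {⌊log₂ p ⌋} 0<H (<2^⌊log₂⌋ {H} {p} 0<L H²<p))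
       (MHs-nonempty 0<H)
       (⊓-bound {∣ M ∣} {π H} 0<s collision-inequality)
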